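{- Let $n\ge 2$ and $a\ge 1$ be integers and set $\alpha=1-1/a$. Consider a deck of $n$ cards with a distinguished card at the bottom (position $n$), and let $Q_a(i)$ be the probability that after an $a$-shuffle this card is at position $i$ from the top. Then for $1\le i\le n$, $$\frac{1}{a}\frac{\alpha^{n-i+1}}{1-\alpha^n}\le Q_a(i)\le\frac{1}{a}\frac{\alpha^{n-i}}{1-\alpha^{n-1}}.$$ In particular, the separation distance $\mathrm{SEP}(a)=\max_{1\le i\le n}\big(1-nQ_a(i)\big)$ of the position of this card from the uniform distribution on $\{1,\dots,n\}$ satisfies $$1-\frac{n}{a}\frac{\alpha^{n-1}}{1-\alpha^{n-1}}\le\mathrm{SEP}(a)\le 1-\frac{n}{a}\frac{\alpha^{n}}{1-\alpha^{n}}.$$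
   Context: An $a$-shuffle of an $n$-card deck: cut the deck from the top into $a$ consecutive packets (possibly empty) of sizes $(A_1,\dots,A_a)$ with probability $a^{ -n}\binom{n}{A_1,\ldots,A_a}$, then interleave the packets by repeatedly dropping a card from a packet chosen with probability proportional to its current size (equivalently, all order-preserving interleavings equally likely). Positions are numbered $1,\dots,n$ from the top. The convention $0^0=1$ is used. -}

module Defs where

open import Data.Nat as ℕ using (ℕ; zero; suc; _<ᵇ_)
open import Data.Nat.Base using (_!)
open import Data.Integer using (+_)
open import Data.Bool using (Bool; true; false; if_then_else_)
open import Data.Fin as Fin using (Fin; toℕ)
open import Data.Fin.Properties using () renaming (_≟_ to _≟ᶠ_)
open import Data.List using (List; []; _∷_; map; foldr; concatMap)
open import Data.Vec.Functional using (Vector; updateAt)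
open import Data.List using (allFin)
open import Relation.Nullary using (yes; no)
open import Data.Rational using (ℚ; 0ℚ; 1ℚ; _+_; _*_; _-_; _÷_; _⊔_; ≢-nonZero)
open import Data.Rational.Properties using (_≟_)
open import Relation.Binary.PropositionalEquality using (_≡_)

ℕ→ℚ : ℕ → ℚ
ℕ→ℚ k = (+ k) Data.Rational./ 1

infixr 8 _^ℚ_
infixl 7 _⊘_

_^ℚ_ : ℚ → ℕ → ℚ
p ^ℚ zero  = 1ℚ
p ^ℚ suc k = p * (p ^ℚ k)

-- total division (p ⊘ 0 = 0); only ever used with nonzero denominators
_⊘_ : ℚ → ℚ → ℚ
p ⊘ q with q ≟ 0ℚ
... | yes _  = 0ℚ
... | no q≢0 = _÷_ p q {{≢-nonZero q≢0}}

sumℚ : List ℚ → ℚ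
sumℚ = foldr _+_ 0ℚ

sumℕ : List ℕ → ℕ
sumℕ = foldr ℕ._+_ 0

productℕ : List ℕ → ℕ
productℕ = foldr ℕ._*_ 1

words : (a n : ℕ) → List (List (Fin a))
words a zero    = [] ∷ []
words a (suc n) = concatMap (λ x → map (x ∷_) (words a n)) (allFin a)

count : {a : ℕ} → Fin a → List (Fin a) → ℕ
count j []       = 0
count j (x ∷ xs) with j ≟ᶠ x
... | yes _ = suc (count j xs)
... | no  _ = count j xs

-- A word w of length n over Fin a encodes one outcome of an a-shuffle:
--   packet sizes  A_j = count j w  (the cut: packet j consists of the cards
--   at original positions  offset j + 1, …, offset j + A_j),
--   and the interleaving: the card put at final position p (top to bottom)
--   is the next (topmost remaining) card of packet  w_p.
-- This is a bijection between a-shuffle outcomes (cut, interleaving) and words.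

packetSize : {a : ℕ} → List (Fin a) → Fin a → ℕ
packetSize w j = count j w

offset : {a : ℕ} → List (Fin a) → Fin a → ℕ
offset {a} w j =
  sumℕ (map (λ j' → if toℕ j' <ᵇ toℕ j then packetSize w j' else 0) (allFin a))

-- resulting deck, listing original card labels (1..n) from top to bottom;
-- used c j = number of cards of packet j already placed
interleave : {a : ℕ} → (Fin a → ℕ) → List (Fin a) → Vector ℕ a → List ℕ
interleave off []       used = []
interleave off (x ∷ xs) used =
  (off x ℕ.+ suc (used x)) ∷ interleave off xs (updateAt used x suc)

shuffledDeck : {a : ℕ} → List (Fin a) → List ℕ
shuffledDeck w = interleave (offset w) w (λ _ → 0)

-- i-th entry (1-indexed) of a list, 0 if out of range
_at_ : List ℕ → ℕ → ℕ
[]       at _             = 0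
(x ∷ xs) at zero          = 0
(x ∷ xs) at suc zero      = x
(x ∷ xs) at suc (suc k)   = xs at suc k

multinomial : (a n : ℕ) → List (Fin a) → ℚ
multinomial a n w =
  ℕ→ℚ (n !) ⊘ ℕ→ℚ (productℕ (map (λ j → packetSize w j !) (allFin a)))

cutProb : (a n : ℕ) → List (Fin a) → ℚ
cutProb a n w = multinomial a n w ⊘ ℕ→ℚ (a ℕ.^ n)

-- probability of a given order-preserving interleaving given the cut:
-- uniform over the multinomial(A) interleavings
interleaveProb : (a n : ℕ) → List (Fin a) → ℚ
interleaveProb a n w = 1ℚ ⊘ multinomial a n w

indicator : ℕ → ℕ → ℚ
indicator x y with x ℕ.≟ y
... | yes _ = 1ℚ
... | no  _ = 0ℚ

Q : (a n i : ℕ) → ℚ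
Q a n i = sumℚ (map (λ w → cutProb a n w * interleaveProb a n w
                              * indicator (shuffledDeck w at i) n)
                    (words a n))

α : ℕ → ℚ
α a = 1ℚ - (1ℚ ⊘ ℕ→ℚ a)

maxUpTo : ℕ → (ℕ → ℚ) → ℚ
maxUpTo zero          f = f 1
maxUpTo (suc zero)    f = f 1
maxUpTo (suc (suc k)) f = maxUpTo (suc k) f ⊔ f (suc (suc k))

SEP : (a n : ℕ) → ℚ
SEP a n = maxUpTo n (λ i → 1ℚ - ℕ→ℚ n * Q a n i)

module Submission where

-- An outcome of an a-shuffle of n cards is a word w ∈ (Fin a)^n (see Defs), and
-- every word has probability a^{-n}: the cut probability a^{-n}·multinomial times
-- the interleaving probability 1/multinomial.  The bottom card lands at position
-- p+1 of an n = p+q+1 card deck iff the (p+1)-st letter k is ≥ every earlier letter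
-- and > every later one; counting words by k gives
--     Q_a(p+1) = S(p,q,a) / a^n,      S(p,q,a) = Σ_{k<a} (k+1)^p k^q.
-- With b = a−1 and m = p+q, each bound of the proposition is a fraction of natural
-- numbers, (1/a)·α^j/(1−α^k) = a^k b^j / (a^{j+1}(a^k − b^k)); after cross-multiplying
-- both bounds reduce to inequalities for S, proved by induction on a:
--     S·(a^m − b^m) ≤ a^m·a^p b^q              (consecutive terms compare geometrically),
--     a^{m+p} b^{q+1} ≤ S·(a^{m+1} − b^{m+1})     (the case p = 0, then a termwise shift).

module FiniteSums where
  open import Defs using (sumℕ)
  open import Data.Nat
  open import Data.Nat.Properties
  open import Data.Fin using (toℕ)
  open import Data.List using (List; []; _∷_; _++_; map; concatMap; allFin; tabulate)
  import Data.List.Properties as List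
  open import Data.Nat.ListAction.Properties using (sum-++)
  open import Data.List.Relation.Unary.All using (All; []; _∷_)
  open import Data.Bool using (if_then_else_)
  open import Data.Sum using (inj₁; inj₂)
  open import Relation.Binary.PropositionalEquality
  open import Relation.Nullary using (¬_; yes; no)
  open import Algebra.Properties.CommutativeSemigroup +-commutativeSemigroup using (interchange)
  open import Data.Empty using (⊥-elim)
  open import Function using (_∘_)

  ind≤ : ℕ → ℕ → ℕ
  ind≤ zero    n       = 1
  ind≤ (suc m) zero    = 0
  ind≤ (suc m) (suc n) = ind≤ m n

  ind< : ℕ → ℕ → ℕ
  ind< m n = ind≤ (suc m) n

  δ : ℕ → ℕ → ℕ
  δ zero    zero    = 1
  δ zero    (suc n) = 0
  δ (suc m) zero    = 0
  δ (suc m) (suc n) = δ m n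

  δ-refl : ∀ m → δ m m ≡ 1
  δ-refl zero    = refl
  δ-refl (suc m) = δ-refl m

  δ-≢ : ∀ m n → ¬ m ≡ n → δ m n ≡ 0
  δ-≢ zero    zero    m≢n = ⊥-elim (m≢n refl)
  δ-≢ zero    (suc n) m≢n = refl
  δ-≢ (suc m) zero    m≢n = refl
  δ-≢ (suc m) (suc n) m≢n = δ-≢ m n (m≢n ∘ cong suc)

  δ-sym : ∀ m n → δ m n ≡ δ n m
  δ-sym zero    zero    = refl
  δ-sym zero    (suc n) = refl
  δ-sym (suc m) zero    = refl
  δ-sym (suc m) (suc n) = δ-sym m n

  ind<-+-δ : ∀ m n → ind< m n + δ m n ≡ ind≤ m n
  ind<-+-δ zero    zero    = refl
  ind<-+-δ zero    (suc n) = refl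
  ind<-+-δ (suc m) zero    = refl
  ind<-+-δ (suc m) (suc n) = ind<-+-δ m n

  ind<-irrefl : ∀ m → ind< m m ≡ 0
  ind<-irrefl zero    = refl
  ind<-irrefl (suc m) = ind<-irrefl m

  ind≤-≤1 : ∀ m n → ind≤ m n ≤ 1
  ind≤-≤1 zero    n       = ≤-refl
  ind≤-≤1 (suc m) zero    = z≤n
  ind≤-≤1 (suc m) (suc n) = ind≤-≤1 m n

  if-<ᵇ : ∀ m n c → (if m <ᵇ n then c else 0) ≡ ind< m n * c
  if-<ᵇ zero    zero    c = refl
  if-<ᵇ zero    (suc n) c = sym (+-identityʳ c)
  if-<ᵇ (suc m) zero    c = refl
  if-<ᵇ (suc m) (suc n) c = if-<ᵇ m n c

  ind≤-δ : ∀ X Y m → ind≤ X Y * δ Y m ≡ ind≤ X m * δ Y m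
  ind≤-δ X Y m with Y ≟ m
  ... | yes refl = refl
  ... | no Y≢m rewrite δ-≢ Y m Y≢m | *-zeroʳ (ind≤ X Y) | *-zeroʳ (ind≤ X m) = refl

  sumTo : ℕ → (ℕ → ℕ) → ℕ
  sumTo zero    f = 0
  sumTo (suc a) f = sumTo a f + f a

  sumTo-*ˡ : ∀ a c f → c * sumTo a f ≡ sumTo a (λ k → c * f k)
  sumTo-*ˡ zero    c f = *-zeroʳ c
  sumTo-*ˡ (suc a) c f =
    trans (*-distribˡ-+ c (sumTo a f) (f a)) (cong (_+ c * f a) (sumTo-*ˡ a c f))

  sumTo-mono : ∀ a f g → (∀ k → k < a → f k ≤ g k) → sumTo a f ≤ sumTo a g
  sumTo-mono zero    f g f≤g = z≤n
  sumTo-mono (suc a) f g f≤g =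
    +-mono-≤ (sumTo-mono a f g (λ k k<a → f≤g k (m≤n⇒m≤1+n k<a))) (f≤g a (n<1+n a))

  sumTo-cong : ∀ a {f g} → (∀ k → k < a → f k ≡ g k) → sumTo a f ≡ sumTo a g
  sumTo-cong zero    f≡g = refl
  sumTo-cong (suc a) f≡g = cong₂ _+_ (sumTo-cong a (λ k k<a → f≡g k (m≤n⇒m≤1+n k<a))) (f≡g a (n<1+n a))

  sumTo-+ : ∀ a (f g : ℕ → ℕ) → sumTo a (λ k → f k + g k) ≡ sumTo a f + sumTo a g
  sumTo-+ zero    f g = refl
  sumTo-+ (suc a) f g rewrite sumTo-+ a f g =
    interchange (sumTo a f) (sumTo a g) (f a) (g a)

  sumTo-*ʳ : ∀ a f c → sumTo a (λ k → f k * c) ≡ sumTo a f * c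
  sumTo-*ʳ zero    f c = refl
  sumTo-*ʳ (suc a) f c = trans (cong (_+ f a * c) (sumTo-*ʳ a f c)) (sym (*-distribʳ-+ c (sumTo a f) (f a)))

  sumTo-zero : ∀ a → sumTo a (λ _ → 0) ≡ 0
  sumTo-zero zero    = refl
  sumTo-zero (suc a) = trans (+-identityʳ _) (sumTo-zero a)

  sumTo-shift : ∀ a f → sumTo (suc a) f ≡ f 0 + sumTo a (f ∘ suc)
  sumTo-shift zero    f = sym (+-identityʳ (f 0))
  sumTo-shift (suc a) f = trans (cong (_+ f (suc a)) (sumTo-shift a f)) (+-assoc (f 0) _ _)

  sumTo-δ-below : ∀ X (F : ℕ → ℕ) → sumTo X (λ k → δ k X * F k) ≡ 0
  sumTo-δ-below X F =
    trans (sumTo-cong X (λ k k<X → cong (_* F k) (δ-≢ k X (<⇒≢ k<X)))) (sumTo-zero X)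

  sumTo-δ : ∀ a (F : ℕ → ℕ) X → X < a → sumTo a (λ k → δ k X * F k) ≡ F X
  sumTo-δ (suc a) F X (s≤s X≤a) with m≤n⇒m<n∨m≡n X≤a
  ... | inj₁ X<a rewrite sumTo-δ a F X X<a | δ-≢ a X (λ a≡X → <-irrefl (sym a≡X) X<a) = +-identityʳ (F X)
  ... | inj₂ refl rewrite sumTo-δ-below X F | δ-refl X = +-identityʳ (F X)

  sumTo-ind< : ∀ a X → X ≤ a → sumTo a (λ k → ind< k X) ≡ X
  sumTo-ind< a X X≤a = trans (count a X) (m≥n⇒m⊓n≡n X≤a)
    where
    step : ∀ a X → a ⊓ X + ind< a X ≡ suc a ⊓ X
    step zero    zero    = refl
    step zero    (suc X) = refl
    step (suc a) zero    = refl
    step (suc a) (suc X) = cong suc (step a X)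
    count : ∀ a X → sumTo a (λ k → ind< k X) ≡ a ⊓ X
    count zero    X = refl
    count (suc a) X rewrite count a X = step a X

  sumOver : {A : Set} → List A → (A → ℕ) → ℕ
  sumOver xs f = sumℕ (map f xs)

  module _ {A : Set} where

    sumOver-cong : ∀ (xs : List A) {f g} → (∀ x → f x ≡ g x) → sumOver xs f ≡ sumOver xs g
    sumOver-cong xs f≡g = cong sumℕ (List.map-cong f≡g xs)

    sumOver-congᴬ : ∀ {xs : List A} {f g} → All (λ x → f x ≡ g x) xs → sumOver xs f ≡ sumOver xs g
    sumOver-congᴬ []       = refl
    sumOver-congᴬ (e ∷ es) = cong₂ _+_ e (sumOver-congᴬ es)

    sumOver-*ˡ : ∀ (xs : List A) c f → sumOver xs (λ x → c * f x) ≡ c * sumOver xs f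
    sumOver-*ˡ []       c f = sym (*-zeroʳ c)
    sumOver-*ˡ (x ∷ xs) c f = trans (cong (c * f x +_) (sumOver-*ˡ xs c f)) (sym (*-distribˡ-+ c (f x) _))

    sumOver-*ʳ : ∀ (xs : List A) f c → sumOver xs (λ x → f x * c) ≡ sumOver xs f * c
    sumOver-*ʳ []       f c = refl
    sumOver-*ʳ (x ∷ xs) f c = trans (cong (f x * c +_) (sumOver-*ʳ xs f c)) (sym (*-distribʳ-+ c (f x) _))

    sumOver-+ : ∀ (xs : List A) (f g : A → ℕ) → sumOver xs (λ x → f x + g x) ≡ sumOver xs f + sumOver xs g
    sumOver-+ []       f g = refl
    sumOver-+ (x ∷ xs) f g rewrite sumOver-+ xs f g = interchange (f x) (g x) (sumOver xs f) (sumOver xs g)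

    sumOver-sumTo : ∀ (xs : List A) a (g : A → ℕ → ℕ) →
                    sumOver xs (λ x → sumTo a (g x)) ≡ sumTo a (λ k → sumOver xs (λ x → g x k))
    sumOver-sumTo []       a g = sym (sumTo-zero a)
    sumOver-sumTo (x ∷ xs) a g =
      trans (cong (sumTo a (g x) +_) (sumOver-sumTo xs a g)) (sym (sumTo-+ a (g x) _))

    sumOver-concatMap : ∀ {B : Set} (g : B → List A) (xs : List B) f →
                        sumOver (concatMap g xs) f ≡ sumOver xs (λ y → sumOver (g y) f)
    sumOver-concatMap g []       f = refl
    sumOver-concatMap g (y ∷ ys) f = begin
      sumℕ (map f (g y ++ concatMap g ys))                  ≡⟨ cong sumℕ (List.map-++ f (g y) _) ⟩
      sumℕ (map f (g y) ++ map f (concatMap g ys))          ≡⟨ sum-++ (map f (g y)) _ ⟩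
      sumOver (g y) f + sumOver (concatMap g ys) f          ≡⟨ cong (sumOver (g y) f +_) (sumOver-concatMap g ys f) ⟩
      sumOver (g y) f + sumOver ys (λ y → sumOver (g y) f)  ∎
      where open ≡-Reasoning

    sumOver-map : ∀ {B : Set} (h : B → A) (xs : List B) f → sumOver (map h xs) f ≡ sumOver xs (f ∘ h)
    sumOver-map h xs f = cong sumℕ (sym (List.map-∘ xs))

  sumOver-allFin : ∀ a F → sumOver (allFin a) (λ j → F (toℕ j)) ≡ sumTo a F
  sumOver-allFin a F = trans (cong sumℕ (List.map-tabulate {n = a} (λ j → j) (λ j → F (toℕ j)))) (sum-tabulate a F)
    where
    sum-tabulate : ∀ a F → sumℕ (tabulate {n = a} (λ j → F (toℕ j))) ≡ sumTo a F
    sum-tabulate zero    F = refl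
    sum-tabulate (suc a) F = trans (cong (F 0 +_) (sum-tabulate a (F ∘ suc))) (sym (sumTo-shift a F))

module PowerSums where
  open import Data.Nat
  open import Data.Nat.Properties
  open import Data.Sum using (inj₁; inj₂)
  open import Relation.Binary.PropositionalEquality
  open import Data.Nat.Tactic.RingSolver using (solve-∀)
  open FiniteSums using (sumTo; sumTo-*ˡ; sumTo-mono)

  term : ℕ → ℕ → ℕ → ℕ
  term p q k = suc k ^ p * k ^ q

  powerSum : ℕ → ℕ → ℕ → ℕ
  powerSum p q a = sumTo a (term p q)

  Δ : ℕ → ℕ → ℕ
  Δ m c = suc c ^ m ∸ c ^ m

  Δ-+ : ∀ m c → Δ m c + c ^ m ≡ suc c ^ m
  Δ-+ m c = m∸n+n≡m (^-monoˡ-≤ m (n≤1+n c))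

  Δ-pos : ∀ m c → 1 ≤ m → 1 ≤ Δ m c
  Δ-pos (suc m) c _ = m<n⇒0<n∸m (^-monoˡ-< (suc m) (n<1+n c))

  ^-distribʳ-* : ∀ x y n → (x * y) ^ n ≡ x ^ n * y ^ n
  ^-distribʳ-* x y zero    = refl
  ^-distribʳ-* x y (suc n) rewrite ^-distribʳ-* x y n = shuffle x y (x ^ n) (y ^ n)
    where shuffle : ∀ x y X Y → x * y * (X * Y) ≡ x * X * (y * Y)
          shuffle = solve-∀

  cancel-pos : ∀ x y e → 1 ≤ e → x * e ≤ y * e → x ≤ y
  cancel-pos x y (suc e) _ = *-cancelʳ-≤ x y (suc e)

  monus-cross : ∀ x y A B C → B ≤ A → C ≤ B → x * A ≤ y * B → y * C ≤ x * B →
                x * (A ∸ B) ≤ y * (B ∸ C)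
  monus-cross x y A B C B≤A C≤B xA≤yB yC≤xB = +-cancelʳ-≤ (x * B) _ _ (begin
    x * (A ∸ B) + x * B   ≡⟨ sym (*-distribˡ-+ x (A ∸ B) B) ⟩
    x * (A ∸ B + B)       ≡⟨ cong (x *_) (m∸n+n≡m B≤A) ⟩
    x * A                 ≤⟨ xA≤yB ⟩
    y * B                 ≡⟨ cong (y *_) (sym (m∸n+n≡m C≤B)) ⟩
    y * (B ∸ C + C)       ≡⟨ *-distribˡ-+ y (B ∸ C) C ⟩
    y * (B ∸ C) + y * C   ≤⟨ +-monoʳ-≤ (y * (B ∸ C)) yC≤xB ⟩
    y * (B ∸ C) + x * B   ∎)
    where open ≤-Reasoning

  pow-cross : ∀ u v w p q → u * w ≤ v * v → v ^ p * w ^ q * u ^ (p + q) ≤ u ^ p * v ^ q * v ^ (p + q)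
  pow-cross u v w p q uw≤vv = begin
    v ^ p * w ^ q * u ^ (p + q)  ≡⟨ split-lhs ⟩
    u ^ p * v ^ p * (u * w) ^ q  ≤⟨ *-monoʳ-≤ (u ^ p * v ^ p) (^-monoˡ-≤ q uw≤vv) ⟩
    u ^ p * v ^ p * (v * v) ^ q  ≡⟨ split-rhs ⟩
    u ^ p * v ^ q * v ^ (p + q)  ∎
    where
    open ≤-Reasoning
    split-lhs : v ^ p * w ^ q * u ^ (p + q) ≡ u ^ p * v ^ p * (u * w) ^ q
    split-lhs rewrite ^-distribˡ-+-* u p q | ^-distribʳ-* u w q =
      rearrange (v ^ p) (w ^ q) (u ^ p) (u ^ q)
      where rearrange : ∀ Vp Wq Up Uq → Vp * Wq * (Up * Uq) ≡ Up * Vp * (Uq * Wq)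
            rearrange = solve-∀
    split-rhs : u ^ p * v ^ p * (v * v) ^ q ≡ u ^ p * v ^ q * v ^ (p + q)
    split-rhs rewrite ^-distribˡ-+-* v p q | ^-distribʳ-* v v q =
      rearrange (u ^ p) (v ^ p) (v ^ q)
      where rearrange : ∀ Up Vp Vq → Up * Vp * (Vq * Vq) ≡ Up * Vq * (Vp * Vq)
            rearrange = solve-∀

  succ-square : ∀ c → suc (suc c) * c ≤ suc c * suc c
  succ-square c = ≤-trans (n≤1+n _) (≤-reflexive (expand c))
    where expand : ∀ c → suc (suc (suc c) * c) ≡ suc c * suc c
          expand = solve-∀

  -- One step of the geometric comparison behind the upper bound:
  -- term c · Δ(c+1) ≤ term (c+1) · Δ c, with Δ = Δ (p+q).
  term-Δ-step : ∀ p q c → term p q c * Δ (p + q) (suc c) ≤ term p q (suc c) * Δ (p + q) c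
  term-Δ-step p q c =
    monus-cross (term p q c) (term p q (suc c)) (suc (suc c) ^ m) (suc c ^ m) (c ^ m)
      (^-monoˡ-≤ m (n≤1+n _)) (^-monoˡ-≤ m (n≤1+n _)) rising falling
    where
    m = p + q
    -- term k / (k+1)^m is nondecreasing
    rising : term p q c * suc (suc c) ^ m ≤ term p q (suc c) * suc c ^ m
    rising = pow-cross (suc (suc c)) (suc c) c p q (succ-square c)
    -- term k / k^m is nonincreasing
    falling : term p q (suc c) * c ^ m ≤ term p q c * suc c ^ m
    falling = begin
      suc (suc c) ^ p * suc c ^ q * c ^ (p + q)  ≡⟨ cong₂ (λ x e → x * c ^ e) (*-comm (suc (suc c) ^ p) _) (+-comm p q) ⟩
      suc c ^ q * suc (suc c) ^ p * c ^ (q + p)  ≤⟨ pow-cross c (suc c) (suc (suc c)) q p (≤-trans (≤-reflexive (*-comm c _)) (succ-square c)) ⟩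
      c ^ q * suc c ^ p * suc c ^ (q + p)        ≡⟨ cong₂ (λ x e → x * suc c ^ e) (*-comm (c ^ q) _) (+-comm q p) ⟩
      suc c ^ p * c ^ q * suc c ^ (p + q)        ∎
      where open ≤-Reasoning

  zero^ : ∀ m → 1 ≤ m → 0 ^ m ≡ 0
  zero^ (suc m) _ = refl

  powerSum-upper : ∀ p q b → 1 ≤ p + q →
                   powerSum p q (suc b) * Δ (p + q) b ≤ suc b ^ (p + q) * term p q b
  powerSum-upper p q zero h = ≤-reflexive (begin
    (0 + t) * (1 ^ m ∸ 0 ^ m)  ≡⟨ cong₂ (λ x y → (0 + t) * (x ∸ y)) (^-zeroˡ m) (zero^ m h) ⟩
    t * 1                       ≡⟨ *-comm t 1 ⟩
    1 * t                       ≡⟨ cong (_* t) (sym (^-zeroˡ m)) ⟩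
    1 ^ m * t                   ∎)
    where open ≡-Reasoning
          m = p + q
          t = term p q 0
  powerSum-upper p q (suc c) h = begin
    (S + t (suc c)) * Δ m (suc c)                 ≡⟨ *-distribʳ-+ (Δ m (suc c)) S (t (suc c)) ⟩
    S * Δ m (suc c) + t (suc c) * Δ m (suc c)     ≤⟨ +-monoˡ-≤ _ previous ⟩
    suc c ^ m * t (suc c) + t (suc c) * Δ m (suc c) ≡⟨ collect (suc c ^ m) (t (suc c)) (Δ m (suc c)) ⟩
    (Δ m (suc c) + suc c ^ m) * t (suc c)         ≡⟨ cong (_* t (suc c)) (Δ-+ m (suc c)) ⟩
    suc (suc c) ^ m * t (suc c)                   ∎
    where
    open ≤-Reasoning
    m = p + q
    t = term p q
    S = powerSum p q (suc c)
    collect : ∀ x y z → x * y + y * z ≡ (z + x) * y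
    collect = solve-∀
    -- the bound for c+1 terms, transported one step by term-Δ-step
    previous : S * Δ m (suc c) ≤ suc c ^ m * t (suc c)
    previous = cancel-pos _ _ (Δ m c) (Δ-pos m c h) (begin
      S * Δ m (suc c) * Δ m c          ≡⟨ *-assoc S _ _ ⟩
      S * (Δ m (suc c) * Δ m c)        ≡⟨ cong (S *_) (*-comm (Δ m (suc c)) _) ⟩
      S * (Δ m c * Δ m (suc c))        ≡⟨ sym (*-assoc S _ _) ⟩
      S * Δ m c * Δ m (suc c)          ≤⟨ *-monoˡ-≤ _ (powerSum-upper p q c h) ⟩
      suc c ^ m * t c * Δ m (suc c)    ≡⟨ *-assoc (suc c ^ m) _ _ ⟩
      suc c ^ m * (t c * Δ m (suc c))  ≤⟨ *-monoʳ-≤ (suc c ^ m) (term-Δ-step p q c) ⟩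
      suc c ^ m * (t (suc c) * Δ m c)  ≡⟨ sym (*-assoc (suc c ^ m) _ _) ⟩
      suc c ^ m * t (suc c) * Δ m c    ∎)

  shifted-power : ∀ c b t m → c ≤ b → suc c * suc t ^ m ≤ (suc t + b) ^ m + c * t ^ m
  shifted-power c b t zero c≤b = ≤-reflexive (base c)
    where base : ∀ c → suc c * 1 ≡ 1 + c * 1
          base = solve-∀
  shifted-power c b t (suc m) c≤b = +-cancelʳ-≤ (U * (c * t ^ m)) _ _ (begin
    suc c * (T * T ^ m) + U * (c * t ^ m)
      ≡⟨ expand c t b (T ^ m) (t ^ m) ⟩
    (suc c * (T * T ^ m) + c * (t * t ^ m)) + (c * t ^ m + b * (c * t ^ m))
      ≤⟨ +-monoʳ-≤ (suc c * (T * T ^ m) + c * (t * t ^ m)) lower-powers ⟩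
    (suc c * (T * T ^ m) + c * (t * t ^ m)) + (b * c * T ^ m + b * T ^ m)
      ≡⟨ regroup c t b (T ^ m) (t ^ m) ⟩
    U * (suc c * T ^ m) + c * (t * t ^ m)
      ≤⟨ +-monoˡ-≤ _ (*-monoʳ-≤ U (shifted-power c b t m c≤b)) ⟩
    U * (U ^ m + c * t ^ m) + c * (t * t ^ m)
      ≡⟨ distribute U (U ^ m) c (t ^ m) t ⟩
    U * U ^ m + c * (t * t ^ m) + U * (c * t ^ m) ∎)
    where
    open ≤-Reasoning
    T = suc t
    U = T + b
    t^≤T^ : t ^ m ≤ T ^ m
    t^≤T^ = ^-monoˡ-≤ m (n≤1+n t)
    lower-powers : c * t ^ m + b * (c * t ^ m) ≤ b * c * T ^ m + b * T ^ m
    lower-powers = ≤-trans (≤-reflexive (+-comm (c * t ^ m) (b * (c * t ^ m))))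
      (+-mono-≤ (≤-trans (≤-reflexive (sym (*-assoc b c (t ^ m)))) (*-monoʳ-≤ (b * c) t^≤T^))
                (*-mono-≤ c≤b t^≤T^))
    expand : ∀ c t b X Y → suc c * ((1 + t) * X) + ((1 + t) + b) * (c * Y)
                         ≡ (suc c * ((1 + t) * X) + c * (t * Y)) + (c * Y + b * (c * Y))
    expand = solve-∀
    regroup : ∀ c t b X Y → (suc c * ((1 + t) * X) + c * (t * Y)) + (b * c * X + b * X)
                          ≡ ((1 + t) + b) * (suc c * X) + c * (t * Y)
    regroup = solve-∀
    distribute : ∀ U V c Y t → U * (V + c * Y) + c * (t * Y) ≡ U * V + c * (t * Y) + U * (c * Y)
    distribute = solve-∀

  module LowerStep (c m : ℕ) where
    a b n : ℕ
    a = suc (suc c)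
    b = suc c
    n = suc m

    -- b^{2m+1} ≤ a^m b^m + a^m c^{m+1}, i.e. b·(ac+1)^m ≤ (ab)^m + c·(ac)^m.
    middle-power : b ^ m * b ^ n ≤ a ^ m * b ^ m + a ^ m * c ^ n
    middle-power = begin
      b ^ m * b ^ n                  ≡⟨ as-square ⟩
      b * (b * b) ^ m                ≡⟨ cong (λ T → b * T ^ m) (square c) ⟩
      suc c * suc (a * c) ^ m        ≤⟨ shifted-power c b (a * c) m (n≤1+n c) ⟩
      (suc (a * c) + b) ^ m + c * (a * c) ^ m
                                     ≡⟨ cong₂ (λ x y → x ^ m + c * y) (ab c) (^-distribʳ-* a c m) ⟩
      (a * b) ^ m + c * (a ^ m * c ^ m) ≡⟨ cong (_+ c * (a ^ m * c ^ m)) (^-distribʳ-* a b m) ⟩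
      a ^ m * b ^ m + c * (a ^ m * c ^ m) ≡⟨ cong (a ^ m * b ^ m +_) (rotate c (a ^ m) (c ^ m)) ⟩
      a ^ m * b ^ m + a ^ m * c ^ n  ∎
      where
      open ≤-Reasoning
      as-square : b ^ m * b ^ n ≡ b * (b * b) ^ m
      as-square rewrite ^-distribʳ-* b b m = rearrange b (b ^ m)
        where rearrange : ∀ b B → B * (b * B) ≡ b * (B * B)
              rearrange = solve-∀
      square : ∀ c → (1 + c) * (1 + c) ≡ suc ((2 + c) * c)
      square = solve-∀
      ab : ∀ c → suc ((2 + c) * c) + (1 + c) ≡ (2 + c) * (1 + c)
      ab = solve-∀
      rotate : ∀ c A C → c * (A * C) ≡ A * (c * C)
      rotate = solve-∀

    middle-power′ : b ^ n * b ^ n + a ^ m * c ^ n ≤ c ^ n * a ^ n + a ^ m * b ^ n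
    middle-power′ = begin
      b * B * (b * B) + Am * (c * C)     ≡⟨ lhs c B Am C ⟩
      b * (B * (b * B)) + Am * (c * C)   ≤⟨ +-monoˡ-≤ _ (*-monoʳ-≤ b middle-power) ⟩
      b * (Am * B + Am * (c * C)) + Am * (c * C) ≡⟨ rhs c B Am C ⟩
      c * C * (a * Am) + Am * (b * B)    ∎
      where
      open ≤-Reasoning
      Am = a ^ m
      B = b ^ m
      C = c ^ m
      lhs : ∀ c B Am C → (1 + c) * B * ((1 + c) * B) + Am * (c * C) ≡ (1 + c) * (B * ((1 + c) * B)) + Am * (c * C)
      lhs = solve-∀
      rhs : ∀ c B Am C → (1 + c) * (Am * B + Am * (c * C)) + Am * (c * C) ≡ c * C * ((2 + c) * Am) + Am * ((1 + c) * B)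
      rhs = solve-∀

    deficit-step : (b ^ n ∸ a ^ m) * Δ n c ≤ c ^ n * Δ n b
    deficit-step with ≤-total (a ^ m) (b ^ n)
    ... | inj₂ b^n≤a^m rewrite m≤n⇒m∸n≡0 b^n≤a^m = z≤n
    ... | inj₁ a^m≤b^n = +-cancelʳ-≤ K _ _ (begin
      G * Eb + K                          ≡⟨ expand G Eb Am Cn ⟩
      (G + Am) * (Eb + Cn) + Am * Cn      ≡⟨ cong₂ (λ u v → u * v + Am * Cn) eG eB ⟩
      Bn * Bn + Am * Cn                   ≤⟨ middle-power′ ⟩
      Cn * An + Am * Bn                   ≡⟨ cong (λ z → Cn * z + Am * Bn) (sym (Δ-+ n b)) ⟩
      Cn * (Ea + Bn) + Am * Bn            ≡⟨ cong₂ (λ u v → Cn * (Ea + u) + Am * v) (sym eG) (sym eB) ⟩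
      Cn * (Ea + (G + Am)) + Am * (Eb + Cn) ≡⟨ collapse G Eb Ea Am Cn ⟩
      Cn * Ea + K                         ∎)
      where
      open ≤-Reasoning
      Am = a ^ m
      An = a ^ n
      Bn = b ^ n
      Cn = c ^ n
      G = Bn ∸ Am
      Ea = Δ n b
      Eb = Δ n c
      K = G * Cn + Am * Eb + Am * Cn + Am * Cn
      eG : G + Am ≡ Bn
      eG = m∸n+n≡m a^m≤b^n
      eB : Eb + Cn ≡ Bn
      eB = Δ-+ n c
      expand : ∀ G Eb Am Cn → G * Eb + (G * Cn + Am * Eb + Am * Cn + Am * Cn) ≡ (G + Am) * (Eb + Cn) + Am * Cn
      expand = solve-∀
      collapse : ∀ G Eb Ea Am Cn → Cn * (Ea + (G + Am)) + Am * (Eb + Cn) ≡ Cn * Ea + (G * Cn + Am * Eb + Am * Cn + Am * Cn)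
      collapse = solve-∀

    excess : a ^ m * b ^ n ≤ b ^ m * Δ n b + b ^ m * (b ^ n ∸ a ^ m)
    excess = +-cancelʳ-≤ (b ^ m * a ^ m) _ _ (begin
      a ^ m * b ^ n + b ^ m * a ^ m               ≡⟨ swap c (a ^ m) (b ^ m) ⟩
      b ^ m * a ^ m + b ^ m * a ^ m * b           ≡⟨ sym (*-suc (b ^ m * a ^ m) b) ⟩
      b ^ m * a ^ m * a                           ≡⟨ *-assoc (b ^ m) (a ^ m) a ⟩
      b ^ m * (a ^ m * a)                         ≡⟨ cong (b ^ m *_) (*-comm (a ^ m) a) ⟩
      b ^ m * a ^ n                               ≡⟨ cong (b ^ m *_) (sym (Δ-+ n b)) ⟩
      b ^ m * (Δ n b + b ^ n)                     ≡⟨ *-distribˡ-+ (b ^ m) _ _ ⟩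
      b ^ m * Δ n b + b ^ m * b ^ n               ≤⟨ +-monoʳ-≤ _ (*-monoʳ-≤ (b ^ m) (m≤n+m∸n (b ^ n) (a ^ m))) ⟩
      b ^ m * Δ n b + b ^ m * (a ^ m + (b ^ n ∸ a ^ m))
        ≡⟨ regroup (b ^ m) (Δ n b) (b ^ n ∸ a ^ m) (a ^ m) ⟩
      b ^ m * Δ n b + b ^ m * (b ^ n ∸ a ^ m) + b ^ m * a ^ m ∎)
      where
      open ≤-Reasoning
      swap : ∀ c A B → A * ((1 + c) * B) + B * A ≡ B * A + B * A * (1 + c)
      swap = solve-∀
      regroup : ∀ B E G A → B * E + B * (A + G) ≡ B * E + B * G + B * A
      regroup = solve-∀

  powerSum-lower₀ : ∀ m b → suc b ^ m * b ^ suc m ≤ powerSum 0 m (suc b) * Δ (suc m) b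
  powerSum-lower₀ m zero =
    subst (_≤ powerSum 0 m 1 * Δ (suc m) 0) (sym (*-zeroʳ (1 ^ m))) z≤n
  powerSum-lower₀ m (suc c) = begin
    a ^ m * b ^ n                               ≤⟨ excess ⟩
    b ^ m * Δ n b + b ^ m * (b ^ n ∸ a ^ m)     ≤⟨ +-monoʳ-≤ _ deficit ⟩
    b ^ m * Δ n b + S * Δ n b                   ≡⟨ collect (b ^ m) (Δ n b) S ⟩
    (S + 1 * b ^ m) * Δ n b                     ∎
    where
    open ≤-Reasoning
    open LowerStep c m
    S = powerSum 0 m b
    collect : ∀ x y z → x * y + z * y ≡ (z + 1 * x) * y
    collect = solve-∀
    deficit : b ^ m * (b ^ n ∸ a ^ m) ≤ S * Δ n b
    deficit = cancel-pos _ _ (Δ n c) (Δ-pos n c (s≤s z≤n)) (begin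
      b ^ m * (b ^ n ∸ a ^ m) * Δ n c    ≡⟨ *-assoc (b ^ m) _ _ ⟩
      b ^ m * ((b ^ n ∸ a ^ m) * Δ n c)  ≤⟨ *-monoʳ-≤ (b ^ m) deficit-step ⟩
      b ^ m * (c ^ n * Δ n b)            ≡⟨ sym (*-assoc (b ^ m) _ _) ⟩
      b ^ m * c ^ n * Δ n b              ≤⟨ *-monoˡ-≤ _ (powerSum-lower₀ m c) ⟩
      S * Δ n c * Δ n b                  ≡⟨ *-assoc S _ _ ⟩
      S * (Δ n c * Δ n b)                ≡⟨ cong (S *_) (*-comm (Δ n c) _) ⟩
      S * (Δ n b * Δ n c)                ≡⟨ sym (*-assoc S _ _) ⟩
      S * Δ n b * Δ n c                  ∎)

  -- Termwise comparison: for k ≤ b, (b+1)^p k^{p+q} ≤ b^p (k+1)^p k^q, since (b+1)k ≤ b(k+1).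
  term-shift : ∀ p q b k → k ≤ b → suc b ^ p * term 0 (p + q) k ≤ b ^ p * term p q k
  term-shift p q b k k≤b = begin
    suc b ^ p * (1 * k ^ (p + q))     ≡⟨ cong (λ z → suc b ^ p * (1 * z)) (^-distribˡ-+-* k p q) ⟩
    suc b ^ p * (1 * (k ^ p * k ^ q)) ≡⟨ rearrange (suc b ^ p) (k ^ p) (k ^ q) ⟩
    suc b ^ p * k ^ p * k ^ q         ≡⟨ cong (_* k ^ q) (sym (^-distribʳ-* (suc b) k p)) ⟩
    (suc b * k) ^ p * k ^ q           ≤⟨ *-monoˡ-≤ (k ^ q) (^-monoˡ-≤ p cross) ⟩
    (b * suc k) ^ p * k ^ q           ≡⟨ cong (_* k ^ q) (^-distribʳ-* b (suc k) p) ⟩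
    b ^ p * suc k ^ p * k ^ q         ≡⟨ *-assoc (b ^ p) (suc k ^ p) (k ^ q) ⟩
    b ^ p * (suc k ^ p * k ^ q)       ∎
    where
    open ≤-Reasoning
    rearrange : ∀ x y z → x * (1 * (y * z)) ≡ x * y * z
    rearrange = solve-∀
    cross : suc b * k ≤ b * suc k
    cross = begin
      k + b * k ≤⟨ +-monoˡ-≤ (b * k) k≤b ⟩
      b + b * k ≡⟨ sym (*-suc b k) ⟩
      b * suc k ∎

  powerSum-shift : ∀ p q b → suc b ^ p * powerSum 0 (p + q) (suc b) ≤ b ^ p * powerSum p q (suc b)
  powerSum-shift p q b = begin
    suc b ^ p * powerSum 0 (p + q) (suc b)               ≡⟨ sumTo-*ˡ (suc b) (suc b ^ p) _ ⟩
    sumTo (suc b) (λ k → suc b ^ p * term 0 (p + q) k)   ≤⟨ sumTo-mono (suc b) _ _ (λ k k<a → term-shift p q b k (s≤s⁻¹ k<a)) ⟩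
    sumTo (suc b) (λ k → b ^ p * term p q k)             ≡⟨ sym (sumTo-*ˡ (suc b) (b ^ p) _) ⟩
    b ^ p * powerSum p q (suc b)                         ∎
    where open ≤-Reasoning

  powerSum-lower : ∀ p q b → suc b ^ (p + (p + q)) * b ^ suc q ≤ powerSum p q (suc b) * Δ (suc (p + q)) b
  powerSum-lower p q zero =
    subst (_≤ powerSum p q 1 * Δ (suc (p + q)) 0) (sym (*-zeroʳ (1 ^ (p + (p + q))))) z≤n
  powerSum-lower p q (suc c) = *-cancelˡ-≤ (b ^ p) {{m^n≢0 b p}} (begin
    b ^ p * (a ^ (p + m) * b ^ suc q)  ≡⟨ regroup ⟩
    a ^ p * (a ^ m * b ^ suc m)        ≤⟨ *-monoʳ-≤ (a ^ p) (powerSum-lower₀ m b) ⟩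
    a ^ p * (S₀ * Δ (suc m) b)         ≡⟨ sym (*-assoc (a ^ p) S₀ _) ⟩
    a ^ p * S₀ * Δ (suc m) b           ≤⟨ *-monoˡ-≤ _ (powerSum-shift p q b) ⟩
    b ^ p * S * Δ (suc m) b            ≡⟨ *-assoc (b ^ p) S _ ⟩
    b ^ p * (S * Δ (suc m) b)          ∎)
    where
    open ≤-Reasoning
    a = suc (suc c)
    b = suc c
    m = p + q
    S₀ = powerSum 0 m a
    S = powerSum p q a
    regroup : b ^ p * (a ^ (p + m) * b ^ suc q) ≡ a ^ p * (a ^ m * b ^ suc m)
    regroup = begin-equality
      b ^ p * (a ^ (p + m) * b ^ suc q)      ≡⟨ cong (λ z → b ^ p * (z * b ^ suc q)) (^-distribˡ-+-* a p m) ⟩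
      b ^ p * (a ^ p * a ^ m * b ^ suc q)    ≡⟨ rearrange (b ^ p) (a ^ p) (a ^ m) (b ^ suc q) ⟩
      a ^ p * (a ^ m * (b ^ p * b ^ suc q))  ≡⟨ cong (λ z → a ^ p * (a ^ m * z)) (sym (^-distribˡ-+-* b p (suc q))) ⟩
      a ^ p * (a ^ m * b ^ (p + suc q))      ≡⟨ cong (λ e → a ^ p * (a ^ m * b ^ e)) (+-suc p q) ⟩
      a ^ p * (a ^ m * b ^ suc m)            ∎
      where rearrange : ∀ x y z w → x * (y * z * w) ≡ y * (z * (x * w))
            rearrange = solve-∀

module ShuffleRecursion where
  open import Defs
  open import Data.Nat
  open import Data.Nat.Properties
  open import Data.Fin using (Fin; toℕ)
  open import Data.Fin.Properties using (toℕ-injective; toℕ<n) renaming (_≟_ to _≟ᶠ_)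
  open import Data.List using (List; []; _∷_; map; zipWith; length; allFin)
  open import Data.Vec.Functional using (updateAt)
  open import Data.Vec.Functional.Properties using (updateAt-updates; updateAt-minimal)
  open import Relation.Binary.PropositionalEquality
  open import Relation.Nullary using (yes; no)
  open import Function using (_∘_)
  open import Algebra.Properties.CommutativeSemigroup +-commutativeSemigroup using (xy∙z≈xz∙y; xy∙z≈y∙xz)
  open FiniteSums

  count-∷ : ∀ {a} (j x : Fin a) w → count j (x ∷ w) ≡ δ (toℕ j) (toℕ x) + count j w
  count-∷ j x w with j ≟ᶠ x
  ... | yes refl rewrite δ-refl (toℕ j) = refl
  ... | no j≢x rewrite δ-≢ (toℕ j) (toℕ x) (j≢x ∘ toℕ-injective) = refl

  lettersBelow : ∀ {a} → ℕ → List (Fin a) → ℕ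
  lettersBelow J []      = 0
  lettersBelow J (y ∷ w) = ind< (toℕ y) J + lettersBelow J w

  lettersBelow-≤ : ∀ {a} J (w : List (Fin a)) → lettersBelow J w ≤ length w
  lettersBelow-≤ J []      = z≤n
  lettersBelow-≤ J (y ∷ w) = +-mono-≤ (ind≤-≤1 (suc (toℕ y)) J) (lettersBelow-≤ J w)

  offset-lettersBelow : ∀ {a} (w : List (Fin a)) j → offset w j ≡ lettersBelow (toℕ j) w
  offset-lettersBelow {a} w j =
    trans (sumOver-cong (allFin a) (λ j′ → if-<ᵇ (toℕ j′) (toℕ j) (count j′ w))) (below w (toℕ j))
    where
    below : ∀ w J → sumOver (allFin a) (λ j′ → ind< (toℕ j′) J * count j′ w) ≡ lettersBelow J w
    below []      J = trans (sumOver-cong (allFin a) (λ j′ → *-zeroʳ (ind< (toℕ j′) J)))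
                            (trans (sumOver-allFin a (λ _ → 0)) (sumTo-zero a))
    below (x ∷ w) J = begin
      sumOver (allFin a) (λ j′ → ind< (toℕ j′) J * count j′ (x ∷ w))
        ≡⟨ sumOver-cong (allFin a) (λ j′ → trans (cong (ind< (toℕ j′) J *_) (count-∷ j′ x w))
                                                 (*-distribˡ-+ (ind< (toℕ j′) J) _ _)) ⟩
      sumOver (allFin a) (λ j′ → ind< (toℕ j′) J * δ (toℕ j′) (toℕ x) + ind< (toℕ j′) J * count j′ w)
        ≡⟨ sumOver-+ (allFin a) _ _ ⟩
      sumOver (allFin a) (λ j′ → ind< (toℕ j′) J * δ (toℕ j′) (toℕ x)) + sumOver (allFin a) (λ j′ → ind< (toℕ j′) J * count j′ w)
        ≡⟨ cong₂ _+_ (sumOver-allFin a (λ k → ind< k J * δ k (toℕ x))) (below w J) ⟩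
      sumTo a (λ k → ind< k J * δ k (toℕ x)) + lettersBelow J w
        ≡⟨ cong (_+ lettersBelow J w) (trans (sumTo-cong a (λ k _ → *-comm (ind< k J) _))
                                             (sumTo-δ a (λ k → ind< k J) (toℕ x) (toℕ<n x))) ⟩
      ind< (toℕ x) J + lettersBelow J w ∎
      where open ≡-Reasoning

  labels : ∀ {a} → (Fin a → ℕ) → List (Fin a) → List ℕ
  labels h []       = []
  labels h (x ∷ xs) = suc (h x) ∷ labels (updateAt h x suc) xs

  updateAt-suc : ∀ {a} (f : Fin a → ℕ) x j → updateAt f x suc j ≡ f j + δ (toℕ x) (toℕ j)
  updateAt-suc f x j with x ≟ᶠ j
  ... | yes refl rewrite updateAt-updates x {suc} f | δ-refl (toℕ x) = +-comm 1 (f x)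
  ... | no x≢j rewrite updateAt-minimal j x {suc} f (x≢j ∘ sym) | δ-≢ (toℕ x) (toℕ j) (x≢j ∘ toℕ-injective) =
    sym (+-identityʳ (f j))

  interleave-labels : ∀ {a} (off used h : Fin a → ℕ) xs → (∀ j → h j ≡ off j + used j) →
                      interleave off xs used ≡ labels h xs
  interleave-labels off used h []       h≡ = refl
  interleave-labels off used h (x ∷ xs) h≡ =
    cong₂ _∷_ (trans (+-suc (off x) (used x)) (cong suc (sym (h≡ x))))
      (interleave-labels off (updateAt used x suc) (updateAt h x suc) xs (λ j → begin
         updateAt h x suc j                   ≡⟨ updateAt-suc h x j ⟩
         h j + δ (toℕ x) (toℕ j)              ≡⟨ cong (_+ δ (toℕ x) (toℕ j)) (h≡ j) ⟩
         off j + used j + δ (toℕ x) (toℕ j)   ≡⟨ +-assoc (off j) (used j) _ ⟩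
         off j + (used j + δ (toℕ x) (toℕ j)) ≡⟨ cong (off j +_) (sym (updateAt-suc used x j)) ⟩
         off j + updateAt used x suc j        ∎))
    where open ≡-Reasoning

  labels-+ : ∀ {a} (h′ h g : Fin a → ℕ) xs → (∀ j → h′ j ≡ h j + g j) →
             labels h′ xs ≡ zipWith _+_ (labels h xs) (map g xs)
  labels-+ h′ h g []       h′≡ = refl
  labels-+ h′ h g (x ∷ xs) h′≡ = cong₂ _∷_ (cong suc (h′≡ x))
    (labels-+ (updateAt h′ x suc) (updateAt h x suc) g xs (λ j → begin
       updateAt h′ x suc j               ≡⟨ updateAt-suc h′ x j ⟩
       h′ j + δ (toℕ x) (toℕ j)          ≡⟨ cong (_+ δ (toℕ x) (toℕ j)) (h′≡ j) ⟩
       h j + g j + δ (toℕ x) (toℕ j)     ≡⟨ xy∙z≈xz∙y (h j) (g j) _ ⟩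
       h j + δ (toℕ x) (toℕ j) + g j     ≡⟨ cong (_+ g j) (sym (updateAt-suc h x j)) ⟩
       updateAt h x suc j + g j          ∎))
    where open ≡-Reasoning

  shuffledDeck-labels : ∀ {a} (w : List (Fin a)) → shuffledDeck w ≡ labels (offset w) w
  shuffledDeck-labels w = interleave-labels (offset w) (λ _ → 0) (offset w) w (λ j → sym (+-identityʳ (offset w j)))

  atOrAfter : ∀ {a} → Fin a → List (Fin a) → List ℕ
  atOrAfter x w = map (λ y → ind≤ (toℕ x) (toℕ y)) w

  -- The shuffle recursion: the first letter x places the top card of packet x,
  -- which is card 1 + #(letters of w below x); every later card of a packet
  -- j ≥ x moves one label down.
  shuffledDeck-∷ : ∀ {a} (x : Fin a) w → shuffledDeck (x ∷ w) ≡
    suc (lettersBelow (toℕ x) w) ∷ zipWith _+_ (shuffledDeck w) (atOrAfter x w)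
  shuffledDeck-∷ x w = trans (shuffledDeck-labels (x ∷ w)) (cong₂ _∷_ top rest)
    where
    top : suc (offset (x ∷ w) x) ≡ suc (lettersBelow (toℕ x) w)
    top = cong suc (trans (offset-lettersBelow (x ∷ w) x) (cong (_+ lettersBelow (toℕ x) w) (ind<-irrefl (toℕ x))))
    shifted : ∀ j → updateAt (offset (x ∷ w)) x suc j ≡ offset w j + ind≤ (toℕ x) (toℕ j)
    shifted j = begin
      updateAt (offset (x ∷ w)) x suc j                             ≡⟨ updateAt-suc (offset (x ∷ w)) x j ⟩
      offset (x ∷ w) j + δ (toℕ x) (toℕ j)                          ≡⟨ cong (_+ δ (toℕ x) (toℕ j)) (offset-lettersBelow (x ∷ w) j) ⟩
      ind< (toℕ x) (toℕ j) + lettersBelow (toℕ j) w + δ (toℕ x) (toℕ j)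
                                                                    ≡⟨ xy∙z≈y∙xz (ind< (toℕ x) (toℕ j)) _ _ ⟩
      lettersBelow (toℕ j) w + (ind< (toℕ x) (toℕ j) + δ (toℕ x) (toℕ j))
                                                                    ≡⟨ cong₂ _+_ (sym (offset-lettersBelow w j)) (ind<-+-δ (toℕ x) (toℕ j)) ⟩
      offset w j + ind≤ (toℕ x) (toℕ j)                             ∎
      where open ≡-Reasoning
    rest : labels (updateAt (offset (x ∷ w)) x suc) w
         ≡ zipWith _+_ (shuffledDeck w) (atOrAfter x w)
    rest = trans (labels-+ _ (offset w) (λ y → ind≤ (toℕ x) (toℕ y)) w shifted)
                 (cong (λ d → zipWith _+_ d (atOrAfter x w)) (sym (shuffledDeck-labels w)))

module BottomCard where
  open import Defs
  open import Data.Nat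
  open import Data.Nat.Properties
  open import Data.Fin using (Fin; toℕ)
  open import Data.List using (List; []; _∷_; map; zipWith; length)
  import Data.List.Properties as List
  open import Relation.Binary.PropositionalEquality
  open FiniteSums
  open ShuffleRecursion

  at-zipWith : ∀ (xs ys : List ℕ) k → length xs ≡ length ys → zipWith _+_ xs ys at k ≡ xs at k + ys at k
  at-zipWith []       []       k             _ = refl
  at-zipWith (x ∷ xs) (y ∷ ys) zero          _ = refl
  at-zipWith (x ∷ xs) (y ∷ ys) (suc zero)    _ = refl
  at-zipWith (x ∷ xs) (y ∷ ys) (suc (suc k)) e = at-zipWith xs ys (suc k) (suc-injective e)

  at-map-≤1 : ∀ {A : Set} (f : A → ℕ) (w : List A) k → (∀ y → f y ≤ 1) → map f w at k ≤ 1
  at-map-≤1 f []      k             f≤1 = z≤n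
  at-map-≤1 f (y ∷ w) zero          f≤1 = z≤n
  at-map-≤1 f (y ∷ w) (suc zero)    f≤1 = f≤1 y
  at-map-≤1 f (y ∷ w) (suc (suc k)) f≤1 = at-map-≤1 f w (suc k) f≤1

  atOrAfter-≤1 : ∀ {a} (x : Fin a) w k → atOrAfter x w at k ≤ 1
  atOrAfter-≤1 x w k = at-map-≤1 _ w k (λ y → ind≤-≤1 (toℕ x) (toℕ y))

  length-shuffledDeck : ∀ {a} (w : List (Fin a)) → length (shuffledDeck w) ≡ length w
  length-shuffledDeck []      = refl
  length-shuffledDeck (x ∷ w) = trans (cong length (shuffledDeck-∷ x w)) (cong suc (begin
    length (zipWith _+_ (shuffledDeck w) (atOrAfter x w))   ≡⟨ List.length-zipWith _+_ (shuffledDeck w) _ ⟩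
    length (shuffledDeck w) ⊓ length (atOrAfter x w)        ≡⟨ cong₂ _⊓_ (length-shuffledDeck w) (List.length-map _ w) ⟩
    length w ⊓ length w                                     ≡⟨ ⊓-idem (length w) ⟩
    length w                                                ∎))
    where open ≡-Reasoning

  same-length : ∀ {a} (x : Fin a) w → length (shuffledDeck w) ≡ length (atOrAfter x w)
  same-length x w = trans (length-shuffledDeck w) (sym (List.length-map _ w))

  by-recursion : ∀ {a} (P : List ℕ → Set) (x : Fin a) w →
                 P (suc (lettersBelow (toℕ x) w) ∷ zipWith _+_ (shuffledDeck w) (atOrAfter x w)) →
                 P (shuffledDeck (x ∷ w))
  by-recursion P x w = subst P (sym (shuffledDeck-∷ x w))

  shuffledDeck-≤ : ∀ {a} (w : List (Fin a)) k → shuffledDeck w at k ≤ length w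
  shuffledDeck-≤ []      k = z≤n
  shuffledDeck-≤ (x ∷ w) k = by-recursion (λ L → L at k ≤ suc (length w)) x w (entry k)
    where
    entry : ∀ k → (suc (lettersBelow (toℕ x) w) ∷ zipWith _+_ (shuffledDeck w) (atOrAfter x w)) at k ≤ suc (length w)
    entry zero          = z≤n
    entry (suc zero)    = s≤s (lettersBelow-≤ (toℕ x) w)
    entry (suc (suc k)) rewrite at-zipWith (shuffledDeck w) (atOrAfter x w) (suc k) (same-length x w) =
      subst (shuffledDeck w at suc k + atOrAfter x w at suc k ≤_) (+-comm (length w) 1) (+-mono-≤ (shuffledDeck-≤ w (suc k)) (atOrAfter-≤1 x w (suc k)))

  δ-shift : ∀ d e L → d ≤ L → e ≤ 1 → δ (e + d) (suc L) ≡ e * δ d L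
  δ-shift d zero          L d≤L _ = δ-≢ d (suc L) (λ d≡1+L → 1+n≰n (subst (_≤ L) d≡1+L d≤L))
  δ-shift d (suc zero)    L _   _ = sym (+-identityʳ (δ d L))
  δ-shift d (suc (suc e)) L _   (s≤s ())

  allBelow : ∀ {a} → ℕ → List (Fin a) → ℕ
  allBelow X []      = 1
  allBelow X (y ∷ w) = ind< (toℕ y) X * allBelow X w

  lettersBelow-all : ∀ {a} X (w : List (Fin a)) → δ (lettersBelow X w) (length w) ≡ allBelow X w
  lettersBelow-all X []      = refl
  lettersBelow-all X (y ∷ w) =
    trans (δ-shift (lettersBelow X w) (ind< (toℕ y) X) (length w) (lettersBelow-≤ X w) (ind≤-≤1 (suc (toℕ y)) X))
          (cong (ind< (toℕ y) X *_) (lettersBelow-all X w))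

  bottomAt : ∀ {a} → List (Fin a) → ℕ → ℕ
  bottomAt []      _             = 0
  bottomAt (x ∷ w) zero          = 0
  bottomAt (x ∷ w) (suc zero)    = allBelow (toℕ x) w
  bottomAt (x ∷ w) (suc (suc k)) = bottomAt w (suc k) * (atOrAfter x w at suc k)

  bottomAt-correct : ∀ {a} (w : List (Fin a)) k → suc k ≤ length w →
                     δ (shuffledDeck w at suc k) (length w) ≡ bottomAt w (suc k)
  bottomAt-correct (x ∷ w) zero    _ =
    by-recursion (λ L → δ (L at 1) (suc (length w)) ≡ allBelow (toℕ x) w) x w (lettersBelow-all (toℕ x) w)
  bottomAt-correct (x ∷ w) (suc k) (s≤s k<n) =
    by-recursion (λ L → δ (L at suc (suc k)) (suc (length w)) ≡ bottomAt w (suc k) * e) x w (begin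
      δ (zipWith _+_ (shuffledDeck w) (atOrAfter x w) at suc k) (suc (length w))
        ≡⟨ cong (λ z → δ z (suc (length w))) (at-zipWith (shuffledDeck w) (atOrAfter x w) (suc k) (same-length x w)) ⟩
      δ (shuffledDeck w at suc k + e) (suc (length w))  ≡⟨ cong (λ z → δ z (suc (length w))) (+-comm _ e) ⟩
      δ (e + shuffledDeck w at suc k) (suc (length w))  ≡⟨ δ-shift _ e (length w) (shuffledDeck-≤ w (suc k)) (atOrAfter-≤1 x w (suc k)) ⟩
      e * δ (shuffledDeck w at suc k) (length w)        ≡⟨ cong (e *_) (bottomAt-correct w k k<n) ⟩
      e * bottomAt w (suc k)                             ≡⟨ *-comm e _ ⟩
      bottomAt w (suc k) * e                             ∎)
    where open ≡-Reasoning
          e = atOrAfter x w at suc k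

module BottomCardCount where
  open import Defs
  open import Data.Nat
  open import Data.Nat.Properties
  open import Data.Fin using (Fin; toℕ)
  open import Data.Fin.Properties using (toℕ<n)
  open import Data.List using (List; []; _∷_; map; length; allFin)
  open import Data.List.Relation.Unary.All as All using (All; []; _∷_)
  import Data.List.Relation.Unary.All.Properties as All
  open import Relation.Binary.PropositionalEquality
  open import Algebra.Properties.CommutativeSemigroup *-commutativeSemigroup using (xy∙z≈xz∙y; x∙yz≈y∙xz)
  open FiniteSums
  open ShuffleRecursion
  open BottomCard
  open PowerSums using (term; powerSum)

  sumOver-words : ∀ {a} n (f : List (Fin a) → ℕ) →
    sumOver (words a (suc n)) f ≡ sumOver (allFin a) (λ x → sumOver (words a n) (λ w → f (x ∷ w)))
  sumOver-words {a} n f = trans (sumOver-concatMap (λ x → map (x ∷_) (words a n)) (allFin a) f)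
    (sumOver-cong (allFin a) (λ x → sumOver-map (x ∷_) (words a n) f))

  words-length : ∀ a n → All (λ w → length w ≡ n) (words a n)
  words-length a zero    = refl ∷ []
  words-length a (suc n) =
    All.concat⁺ {xss = map extend (allFin a)} (All.map⁺ {f = extend} (All.tabulate⁺ {f = λ x → x} (λ x →
      All.map⁺ {f = x ∷_} (All.map {Q = λ w → length (x ∷ w) ≡ suc n} (cong suc) (words-length a n)))))
    where extend = λ (x : Fin a) → map (x ∷_) (words a n)

  count-allBelow : ∀ {a} n X → X ≤ a → sumOver (words a n) (allBelow X) ≡ X ^ n
  count-allBelow         zero    X X≤a = refl
  count-allBelow {a} (suc n) X X≤a = begin
    sumOver (words a (suc n)) (allBelow X)
      ≡⟨ sumOver-words {a} n (allBelow X) ⟩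
    sumOver (allFin a) (λ x → sumOver (words a n) (λ w → ind< (toℕ x) X * allBelow X w))
      ≡⟨ sumOver-cong (allFin a) (λ x → trans (sumOver-*ˡ (words a n) (ind< (toℕ x) X) (allBelow X))
                                              (cong (ind< (toℕ x) X *_) (count-allBelow n X X≤a))) ⟩
    sumOver (allFin a) (λ x → ind< (toℕ x) X * X ^ n)
      ≡⟨ sumOver-allFin a (λ k → ind< k X * X ^ n) ⟩
    sumTo a (λ k → ind< k X * X ^ n)
      ≡⟨ sumTo-*ʳ a (λ k → ind< k X) (X ^ n) ⟩
    sumTo a (λ k → ind< k X) * X ^ n
      ≡⟨ cong (_* X ^ n) (sumTo-ind< a X X≤a) ⟩
    X * X ^ n ∎
    where open ≡-Reasoning

  letterIs : ∀ {a} → ℕ → List (Fin a) → ℕ → ℕ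
  letterIs m w i = map (λ y → δ (toℕ y) m) w at i

  bottomAt-letter : ∀ {a} (w : List (Fin a)) i → bottomAt w i * sumTo a (λ m → letterIs m w i) ≡ bottomAt w i
  bottomAt-letter []      i = refl
  bottomAt-letter (x ∷ w) zero = refl
  bottomAt-letter {a} (x ∷ w) (suc zero) = trans (cong (allBelow (toℕ x) w *_) one-letter) (*-identityʳ _)
    where
    one-letter : sumTo a (λ m → δ (toℕ x) m) ≡ 1
    one-letter = trans (sumTo-cong a (λ m _ → trans (δ-sym (toℕ x) m) (sym (*-identityʳ (δ m (toℕ x))))))
                       (sumTo-δ a (λ _ → 1) (toℕ x) (toℕ<n x))
  bottomAt-letter {a} (x ∷ w) (suc (suc k)) =
    trans (xy∙z≈xz∙y (bottomAt w (suc k)) e (sumTo a (λ m → letterIs m w (suc k))))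
          (cong (_* e) (bottomAt-letter w (suc k)))
    where e = atOrAfter x w at suc k

  atOrAfter-letterIs : ∀ {a} (x : Fin a) w m k →
    (atOrAfter x w at k) * letterIs m w k ≡ ind≤ (toℕ x) m * letterIs m w k
  atOrAfter-letterIs x []      m k             = sym (*-zeroʳ (ind≤ (toℕ x) m))
  atOrAfter-letterIs x (y ∷ w) m zero          = sym (*-zeroʳ (ind≤ (toℕ x) m))
  atOrAfter-letterIs x (y ∷ w) m (suc zero)    = ind≤-δ (toℕ x) (toℕ y) m
  atOrAfter-letterIs x (y ∷ w) m (suc (suc k)) = atOrAfter-letterIs x w m (suc k)

  -- Words of length p+q+1 putting the bottom card at position p+1 with letter m
  -- there: the p earlier letters are ≤ m, the q later ones are < m.
  count-bottomAt-letter : ∀ {a} p q m → m < a →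
    sumOver (words a (suc (p + q))) (λ w → bottomAt w (suc p) * letterIs m w (suc p)) ≡ term p q m
  count-bottomAt-letter {a} zero q m m<a = begin
    sumOver (words a (suc q)) (λ w → bottomAt w 1 * letterIs m w 1)
      ≡⟨ sumOver-words {a} q (λ w → bottomAt w 1 * letterIs m w 1) ⟩
    sumOver (allFin a) (λ x → sumOver (words a q) (λ w → allBelow (toℕ x) w * δ (toℕ x) m))
      ≡⟨ sumOver-cong (allFin a) (λ x → trans (sumOver-*ʳ (words a q) (allBelow (toℕ x)) (δ (toℕ x) m))
                                              (cong (_* δ (toℕ x) m) (count-allBelow q (toℕ x) (<⇒≤ (toℕ<n x))))) ⟩
    sumOver (allFin a) (λ x → toℕ x ^ q * δ (toℕ x) m)
      ≡⟨ sumOver-allFin a (λ k → k ^ q * δ k m) ⟩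
    sumTo a (λ k → k ^ q * δ k m)
      ≡⟨ trans (sumTo-cong a (λ k _ → *-comm (k ^ q) (δ k m))) (sumTo-δ a (λ k → k ^ q) m m<a) ⟩
    m ^ q
      ≡⟨ sym (*-identityˡ (m ^ q)) ⟩
    1 * m ^ q ∎
    where open ≡-Reasoning
  count-bottomAt-letter {a} (suc p) q m m<a = begin
    sumOver (words a (suc (suc (p + q)))) (λ w → bottomAt w (suc (suc p)) * letterIs m w (suc (suc p)))
      ≡⟨ sumOver-words {a} (suc (p + q)) _ ⟩
    sumOver (allFin a) (λ x → sumOver ws (λ w → bottomAt w (suc p) * (atOrAfter x w at suc p) * letterIs m w (suc p)))
      ≡⟨ sumOver-cong (allFin a) (λ x → trans (sumOver-cong ws (restrict x))
           (trans (sumOver-*ˡ ws (ind≤ (toℕ x) m) _) (cong (ind≤ (toℕ x) m *_) (count-bottomAt-letter p q m m<a)))) ⟩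
    sumOver (allFin a) (λ x → ind≤ (toℕ x) m * term p q m)
      ≡⟨ sumOver-allFin a (λ k → ind≤ k m * term p q m) ⟩
    sumTo a (λ k → ind< k (suc m) * term p q m)
      ≡⟨ sumTo-*ʳ a (λ k → ind< k (suc m)) _ ⟩
    sumTo a (λ k → ind< k (suc m)) * term p q m
      ≡⟨ cong (_* term p q m) (sumTo-ind< a (suc m) m<a) ⟩
    suc m * (suc m ^ p * m ^ q)
      ≡⟨ sym (*-assoc (suc m) (suc m ^ p) (m ^ q)) ⟩
    suc m ^ suc p * m ^ q ∎
    where
    open ≡-Reasoning
    ws = words a (suc (p + q))
    restrict : ∀ (x : Fin a) w → bottomAt w (suc p) * (atOrAfter x w at suc p) * letterIs m w (suc p)
                               ≡ ind≤ (toℕ x) m * (bottomAt w (suc p) * letterIs m w (suc p))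
    restrict x w = begin
      bottomAt w (suc p) * (atOrAfter x w at suc p) * letterIs m w (suc p)
        ≡⟨ *-assoc (bottomAt w (suc p)) _ _ ⟩
      bottomAt w (suc p) * ((atOrAfter x w at suc p) * letterIs m w (suc p))
        ≡⟨ cong (bottomAt w (suc p) *_) (atOrAfter-letterIs x w m (suc p)) ⟩
      bottomAt w (suc p) * (ind≤ (toℕ x) m * letterIs m w (suc p))
        ≡⟨ x∙yz≈y∙xz (bottomAt w (suc p)) (ind≤ (toℕ x) m) _ ⟩
      ind≤ (toℕ x) m * (bottomAt w (suc p) * letterIs m w (suc p)) ∎

  count-bottomAt : ∀ a p q → sumOver (words a (suc (p + q))) (λ w → bottomAt w (suc p)) ≡ powerSum p q a
  count-bottomAt a p q = begin
    sumOver ws (λ w → bottomAt w (suc p))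
      ≡⟨ sumOver-cong ws (λ w → sym (bottomAt-letter w (suc p))) ⟩
    sumOver ws (λ w → bottomAt w (suc p) * sumTo a (λ m → letterIs m w (suc p)))
      ≡⟨ sumOver-cong ws (λ w → sumTo-*ˡ a (bottomAt w (suc p)) _) ⟩
    sumOver ws (λ w → sumTo a (λ m → bottomAt w (suc p) * letterIs m w (suc p)))
      ≡⟨ sumOver-sumTo ws a (λ w m → bottomAt w (suc p) * letterIs m w (suc p)) ⟩
    sumTo a (λ m → sumOver ws (λ w → bottomAt w (suc p) * letterIs m w (suc p)))
      ≡⟨ sumTo-cong a (λ m m<a → count-bottomAt-letter p q m m<a) ⟩
    powerSum p q a ∎
    where open ≡-Reasoning
          ws = words a (suc (p + q))

  bottom-card-count : ∀ a p q →
    sumOver (words a (suc (p + q))) (λ w → δ (shuffledDeck w at suc p) (suc (p + q))) ≡ powerSum p q a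
  bottom-card-count a p q = trans (sumOver-congᴬ (All.map (λ {w} → characterise w) (words-length a (suc (p + q)))))
                                  (count-bottomAt a p q)
    where
    characterise : ∀ w → length w ≡ suc (p + q) →
                   δ (shuffledDeck w at suc p) (suc (p + q)) ≡ bottomAt w (suc p)
    characterise w len = trans (cong (δ (shuffledDeck w at suc p)) (sym len))
      (bottomAt-correct w p (subst (suc p ≤_) (sym len) (s≤s (m≤m+n p q))))

module Fractions where
  open import Defs using (ℕ→ℚ; _^ℚ_; _⊘_; sumℚ; sumℕ)
  open import Data.List using (List; []; _∷_; map)
  open import Data.Nat as ℕ using (ℕ; zero; suc)
  import Data.Nat.Properties as ℕ
  open import Data.Integer as ℤ using (+_)
  import Data.Integer.Properties as ℤ
  open import Data.Rational using (ℚ; 0ℚ; 1ℚ; _+_; _*_; _-_; _≤_; _<_; mkℚ; *≤*; *<*; 1/_; ≢-nonZero; nonNegative; positive)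
  open import Data.Rational.Properties
  open import Data.Rational.Solver using (module +-*-Solver)
  open +-*-Solver using (solve; _:+_; _:*_; _:-_; _:=_; con)
  open import Data.Nat.Coprimality using (1-coprimeTo) renaming (sym to coprime-sym)
  open import Data.Empty using (⊥-elim)
  open import Relation.Binary.PropositionalEquality
  open import Relation.Nullary using (yes; no; ¬_)

  ℕ→ℚ-mkℚ : ∀ k → ℕ→ℚ k ≡ mkℚ (+ k) 0 (coprime-sym (1-coprimeTo k))
  ℕ→ℚ-mkℚ k = normalize-coprime (coprime-sym (1-coprimeTo k))

  ℕ→ℚ-+ : ∀ m n → ℕ→ℚ (m ℕ.+ n) ≡ ℕ→ℚ m + ℕ→ℚ n
  ℕ→ℚ-+ m n = trans (cong (λ z → z Data.Rational./ 1) numerator) (sym (cong₂ _+_ (ℕ→ℚ-mkℚ m) (ℕ→ℚ-mkℚ n)))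
    where numerator : + (m ℕ.+ n) ≡ + m ℤ.* + 1 ℤ.+ + n ℤ.* + 1
          numerator = trans (ℤ.pos-+ m n) (sym (cong₂ ℤ._+_ (ℤ.*-identityʳ (+ m)) (ℤ.*-identityʳ (+ n))))

  ℕ→ℚ-* : ∀ m n → ℕ→ℚ (m ℕ.* n) ≡ ℕ→ℚ m * ℕ→ℚ n
  ℕ→ℚ-* m n = trans (cong (λ z → z Data.Rational./ 1) (ℤ.pos-* m n)) (sym (cong₂ _*_ (ℕ→ℚ-mkℚ m) (ℕ→ℚ-mkℚ n)))

  ℕ→ℚ-^ : ∀ k n → ℕ→ℚ (k ℕ.^ n) ≡ ℕ→ℚ k ^ℚ n
  ℕ→ℚ-^ k zero    = refl
  ℕ→ℚ-^ k (suc n) = trans (ℕ→ℚ-* k (k ℕ.^ n)) (cong (ℕ→ℚ k *_) (ℕ→ℚ-^ k n))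

  ℕ→ℚ-∸ : ∀ {m n} → n ℕ.≤ m → ℕ→ℚ (m ℕ.∸ n) ≡ ℕ→ℚ m - ℕ→ℚ n
  ℕ→ℚ-∸ {m} {n} n≤m = begin
    ℕ→ℚ (m ℕ.∸ n)                          ≡⟨ solve 2 (λ x y → x := (x :+ y) :- y) refl (ℕ→ℚ (m ℕ.∸ n)) (ℕ→ℚ n) ⟩
    (ℕ→ℚ (m ℕ.∸ n) + ℕ→ℚ n) - ℕ→ℚ n       ≡⟨ cong (_- ℕ→ℚ n) (sym (ℕ→ℚ-+ (m ℕ.∸ n) n)) ⟩
    ℕ→ℚ (m ℕ.∸ n ℕ.+ n) - ℕ→ℚ n           ≡⟨ cong (λ z → ℕ→ℚ z - ℕ→ℚ n) (ℕ.m∸n+n≡m n≤m) ⟩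
    ℕ→ℚ m - ℕ→ℚ n                          ∎
    where open ≡-Reasoning

  ℕ→ℚ-mono-≤ : ∀ {m n} → m ℕ.≤ n → ℕ→ℚ m ≤ ℕ→ℚ n
  ℕ→ℚ-mono-≤ {m} {n} m≤n rewrite ℕ→ℚ-mkℚ m | ℕ→ℚ-mkℚ n =
    *≤* (subst₂ ℤ._≤_ (sym (ℤ.*-identityʳ (+ m))) (sym (ℤ.*-identityʳ (+ n))) (ℤ.+≤+ m≤n))

  ℕ→ℚ-pos : ∀ {n} → 1 ℕ.≤ n → 0ℚ < ℕ→ℚ n
  ℕ→ℚ-pos {n} 1≤n rewrite ℕ→ℚ-mkℚ n =
    *<* (subst₂ ℤ._<_ refl (sym (ℤ.*-identityʳ (+ n))) (ℤ.+<+ 1≤n))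

  sumℚ-linear : ∀ {A : Set} c (f : A → ℕ) xs → sumℚ (map (λ x → c * ℕ→ℚ (f x)) xs) ≡ c * ℕ→ℚ (sumℕ (map f xs))
  sumℚ-linear c f []       = sym (*-zeroʳ c)
  sumℚ-linear c f (x ∷ xs) = trans (cong (λ s → c * ℕ→ℚ (f x) + s) (sumℚ-linear c f xs))
    (trans (sym (*-distribˡ-+ c _ _)) (cong (c *_) (sym (ℕ→ℚ-+ (f x) _))))

  pos⇒≢0 : ∀ {x} → 0ℚ < x → ¬ x ≡ 0ℚ
  pos⇒≢0 0<x refl = <-irrefl refl 0<x

  0≤-* : ∀ {x y} → 0ℚ ≤ x → 0ℚ ≤ y → 0ℚ ≤ x * y
  0≤-* {x} {y} 0≤x 0≤y = nonNegative⁻¹ (x * y) {{nonNeg*nonNeg⇒nonNeg x {{nonNegative 0≤x}} y {{nonNegative 0≤y}}}}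

  0<-* : ∀ {x y} → 0ℚ < x → 0ℚ < y → 0ℚ < x * y
  0<-* {x} {y} 0<x 0<y = positive⁻¹ (x * y) {{pos*pos⇒pos x {{positive 0<x}} y {{positive 0<y}}}}

  0<-^ : ∀ {x} n → 0ℚ < x → 0ℚ < x ^ℚ n
  0<-^ zero    0<x = ℕ→ℚ-pos {1} (ℕ.s≤s ℕ.z≤n)
  0<-^ (suc n) 0<x = 0<-* 0<x (0<-^ n 0<x)

  0≤-^ : ∀ {x} n → 0ℚ ≤ x → 0ℚ ≤ x ^ℚ n
  0≤-^ zero    0≤x = ℕ→ℚ-mono-≤ {0} {1} ℕ.z≤n
  0≤-^ (suc n) 0≤x = 0≤-* 0≤x (0≤-^ n 0≤x)

  ^ℚ-distrib-* : ∀ x y n → (x * y) ^ℚ n ≡ x ^ℚ n * y ^ℚ n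
  ^ℚ-distrib-* x y zero    = refl
  ^ℚ-distrib-* x y (suc n) rewrite ^ℚ-distrib-* x y n =
    solve 4 (λ x y X Y → (x :* y) :* (X :* Y) := (x :* X) :* (y :* Y)) refl x y (x ^ℚ n) (y ^ℚ n)

  ^ℚ-antitone : ∀ {x} d k → 0ℚ ≤ x → x ≤ 1ℚ → x ^ℚ (d ℕ.+ k) ≤ x ^ℚ k
  ^ℚ-antitone zero    k 0≤x x≤1 = ≤-refl
  ^ℚ-antitone {x} (suc d) k 0≤x x≤1 = begin
    x * x ^ℚ (d ℕ.+ k)  ≤⟨ *-monoʳ-≤-nonNeg (x ^ℚ (d ℕ.+ k)) {{nonNegative (0≤-^ (d ℕ.+ k) 0≤x)}} x≤1 ⟩
    1ℚ * x ^ℚ (d ℕ.+ k) ≡⟨ *-identityˡ _ ⟩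
    x ^ℚ (d ℕ.+ k)      ≤⟨ ^ℚ-antitone d k 0≤x x≤1 ⟩
    x ^ℚ k              ∎
    where open ≤-Reasoning

  ⊘-def : ∀ x y (y≢0 : ¬ y ≡ 0ℚ) → x ⊘ y ≡ x * (1/ y) {{≢-nonZero y≢0}}
  ⊘-def x y y≢0 with y ≟ 0ℚ
  ... | yes y≡0 = ⊥-elim (y≢0 y≡0)
  ... | no  _   = refl

  ⊘-cancel : ∀ x {y} → 0ℚ < y → (x ⊘ y) * y ≡ x
  ⊘-cancel x {y} 0<y rewrite ⊘-def x y (pos⇒≢0 0<y) = begin
    x * (1/ y) * y   ≡⟨ *-assoc x _ y ⟩
    x * ((1/ y) * y) ≡⟨ cong (x *_) (*-inverseˡ y) ⟩
    x * 1ℚ           ≡⟨ *-identityʳ x ⟩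
    x                ∎
    where open ≡-Reasoning
          instance _ = ≢-nonZero (pos⇒≢0 0<y)

  ⊘-unique : ∀ x {y} z → 0ℚ < y → z * y ≡ x → x ⊘ y ≡ z
  ⊘-unique x {y} z 0<y zy≡x rewrite ⊘-def x y (pos⇒≢0 0<y) = begin
    x * (1/ y)       ≡⟨ cong (_* (1/ y)) (sym zy≡x) ⟩
    z * y * (1/ y)   ≡⟨ *-assoc z y _ ⟩
    z * (y * (1/ y)) ≡⟨ cong (z *_) (*-inverseʳ y) ⟩
    z * 1ℚ           ≡⟨ *-identityʳ z ⟩
    z                ∎
    where open ≡-Reasoning
          instance _ = ≢-nonZero (pos⇒≢0 0<y)

  0<-⊘ : ∀ {x y} → 0ℚ < x → 0ℚ < y → 0ℚ < x ⊘ y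
  0<-⊘ {x} {y} 0<x 0<y = subst (0ℚ <_) (sym (⊘-def x y (pos⇒≢0 0<y))) (0<-* 0<x 0<1/y)
    where
    instance _ = positive 0<y
    0<1/y : 0ℚ < (1/ y) {{≢-nonZero (pos⇒≢0 0<y)}}
    0<1/y = positive⁻¹ ((1/ y) {{pos⇒nonZero y}}) {{1/pos⇒pos y}}

  ⊘-* : ∀ x {y} z {w} → 0ℚ < y → 0ℚ < w → (x ⊘ y) * (z ⊘ w) ≡ (x * z) ⊘ (y * w)
  ⊘-* x {y} z {w} 0<y 0<w = sym (⊘-unique (x * z) _ (0<-* 0<y 0<w) (begin
    (x ⊘ y) * (z ⊘ w) * (y * w)  ≡⟨ solve 4 (λ u v y w → u :* v :* (y :* w) := (u :* y) :* (v :* w)) refl (x ⊘ y) (z ⊘ w) y w ⟩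
    (x ⊘ y) * y * ((z ⊘ w) * w)  ≡⟨ cong₂ _*_ (⊘-cancel x 0<y) (⊘-cancel z 0<w) ⟩
    x * z                        ∎))
    where open ≡-Reasoning

  ⊘-scale : ∀ x {y} c → 0ℚ < y → 0ℚ < c → (x * c) ⊘ (y * c) ≡ x ⊘ y
  ⊘-scale x {y} c 0<y 0<c = ⊘-unique (x * c) (x ⊘ y) (0<-* 0<y 0<c) (begin
    (x ⊘ y) * (y * c) ≡⟨ sym (*-assoc (x ⊘ y) y c) ⟩
    (x ⊘ y) * y * c   ≡⟨ cong (_* c) (⊘-cancel x 0<y) ⟩
    x * c             ∎)
    where open ≡-Reasoning

  ⊘-⊘ : ∀ x {y z w} → 0ℚ < y → 0ℚ < z → 0ℚ < w → (x ⊘ y) ⊘ (z ⊘ w) ≡ (x * w) ⊘ (y * z)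
  ⊘-⊘ x {y} {z} {w} 0<y 0<z 0<w = ⊘-unique (x ⊘ y) ((x * w) ⊘ (y * z)) (0<-⊘ 0<z 0<w) (begin
    ((x * w) ⊘ (y * z)) * (z ⊘ w)  ≡⟨ ⊘-* (x * w) z (0<-* 0<y 0<z) 0<w ⟩
    (x * w * z) ⊘ (y * z * w)      ≡⟨ cong₂ _⊘_ (*-assoc x w z) (*-assoc y z w) ⟩
    (x * (w * z)) ⊘ (y * (z * w))  ≡⟨ cong (λ c → (x * c) ⊘ (y * (z * w))) (*-comm w z) ⟩
    (x * (z * w)) ⊘ (y * (z * w))  ≡⟨ ⊘-scale x (z * w) 0<y (0<-* 0<z 0<w) ⟩
    x ⊘ y                          ∎)
    where open ≡-Reasoning

  ⊘-^ : ∀ x {y} n → 0ℚ < y → (x ⊘ y) ^ℚ n ≡ x ^ℚ n ⊘ y ^ℚ n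
  ⊘-^ x {y} n 0<y = sym (⊘-unique (x ^ℚ n) _ (0<-^ n 0<y) (begin
    (x ⊘ y) ^ℚ n * y ^ℚ n  ≡⟨ sym (^ℚ-distrib-* (x ⊘ y) y n) ⟩
    ((x ⊘ y) * y) ^ℚ n     ≡⟨ cong (_^ℚ n) (⊘-cancel x 0<y) ⟩
    x ^ℚ n                 ∎))
    where open ≡-Reasoning

  1-⊘ : ∀ x {y} → 0ℚ < y → 1ℚ - x ⊘ y ≡ (y - x) ⊘ y
  1-⊘ x {y} 0<y = sym (⊘-unique (y - x) _ 0<y (begin
    (1ℚ - x ⊘ y) * y    ≡⟨ solve 2 (λ u y → (con 1ℚ :- u) :* y := y :- u :* y) refl (x ⊘ y) y ⟩
    y - (x ⊘ y) * y     ≡⟨ cong (y -_) (⊘-cancel x 0<y) ⟩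
    y - x               ∎))
    where open ≡-Reasoning

  1⊘-* : ∀ x {y} → 0ℚ < y → (1ℚ ⊘ y) * x ≡ x ⊘ y
  1⊘-* x {y} 0<y = sym (⊘-unique x _ 0<y (begin
    (1ℚ ⊘ y) * x * y  ≡⟨ solve 3 (λ u x y → u :* x :* y := u :* y :* x) refl (1ℚ ⊘ y) x y ⟩
    (1ℚ ⊘ y) * y * x  ≡⟨ cong (_* x) (⊘-cancel 1ℚ 0<y) ⟩
    1ℚ * x            ≡⟨ *-identityˡ x ⟩
    x                 ∎))
    where open ≡-Reasoning

  ⊘-monoˡ-≤ : ∀ {x z} y → 0ℚ < y → x ≤ z → x ⊘ y ≤ z ⊘ y
  ⊘-monoˡ-≤ {x} {z} y 0<y x≤z = begin
    x ⊘ y          ≡⟨ sym (1⊘-* x 0<y) ⟩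
    (1ℚ ⊘ y) * x   ≤⟨ *-monoˡ-≤-nonNeg (1ℚ ⊘ y) {{nonNegative (<⇒≤ (0<-⊘ (ℕ→ℚ-pos {1} (ℕ.s≤s ℕ.z≤n)) 0<y))}} x≤z ⟩
    (1ℚ ⊘ y) * z   ≡⟨ 1⊘-* z 0<y ⟩
    z ⊘ y          ∎
    where open ≤-Reasoning

  ⊘-cross-≤ : ∀ x {y} z {w} → 0ℚ < y → 0ℚ < w → x * w ≤ z * y → x ⊘ y ≤ z ⊘ w
  ⊘-cross-≤ x {y} z {w} 0<y 0<w xw≤zy = begin
    x ⊘ y              ≡⟨ sym (⊘-scale x w 0<y 0<w) ⟩
    (x * w) ⊘ (y * w)  ≤⟨ ⊘-monoˡ-≤ (y * w) (0<-* 0<y 0<w) xw≤zy ⟩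
    (z * y) ⊘ (y * w)  ≡⟨ cong ((z * y) ⊘_) (*-comm y w) ⟩
    (z * y) ⊘ (w * y)  ≡⟨ ⊘-scale z y 0<w 0<y ⟩
    z ⊘ w              ∎
    where open ≤-Reasoning

  ℕ-fraction-≤ : ∀ x y z w → 1 ℕ.≤ y → 1 ℕ.≤ w → x ℕ.* w ℕ.≤ z ℕ.* y →
                 ℕ→ℚ x ⊘ ℕ→ℚ y ≤ ℕ→ℚ z ⊘ ℕ→ℚ w
  ℕ-fraction-≤ x y z w 1≤y 1≤w xw≤zy = ⊘-cross-≤ (ℕ→ℚ x) (ℕ→ℚ z) (ℕ→ℚ-pos 1≤y) (ℕ→ℚ-pos 1≤w)
    (subst₂ _≤_ (ℕ→ℚ-* x w) (ℕ→ℚ-* z y) (ℕ→ℚ-mono-≤ xw≤zy))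

open import Defs
open import Data.Nat using (ℕ; _∸_; _+_) renaming (_≤_ to _≤ℕ_)
open import Data.Product using (_×_)
open import Data.Rational using (ℚ; 1ℚ; _*_; _-_; _≤_)

import Data.Nat as ℕ
import Data.Nat.Properties as ℕ
open import Data.Nat using (zero; suc; z≤n; s≤s)
open import Data.Nat.Tactic.RingSolver using (solve-∀)
open import Data.Fin using (Fin)
open import Data.List using (List; []; _∷_; map; allFin)
import Data.List.Properties as List
open import Data.Product using (_,_; proj₁; proj₂)
open import Data.Rational using (0ℚ; _<_; nonNegative)
open import Data.Rational.Properties
open import Relation.Binary.PropositionalEquality
open import Relation.Nullary using (yes; no)

open FiniteSums using (δ; δ-refl; δ-≢; sumOver)
open PowerSums using (powerSum; Δ; Δ-pos; powerSum-upper; powerSum-lower)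
open BottomCardCount using (bottom-card-count)
open Fractions

indicator-δ : ∀ x y → indicator x y ≡ ℕ→ℚ (δ x y)
indicator-δ x y with x ℕ.≟ y
... | yes refl rewrite δ-refl x = refl
... | no  x≢y  rewrite δ-≢ x y x≢y = refl

productℕ-pos : ∀ {A : Set} (f : A → ℕ) xs → (∀ x → 1 ≤ℕ f x) → 1 ≤ℕ productℕ (map f xs)
productℕ-pos f []       f≥1 = s≤s z≤n
productℕ-pos f (x ∷ xs) f≥1 = ℕ.*-mono-≤ (f≥1 x) (productℕ-pos f xs f≥1)

outcome-probability : ∀ a n w → 1 ≤ℕ a →
                      cutProb a n w * interleaveProb a n w ≡ 1ℚ ⊘ ℕ→ℚ (a ℕ.^ n)
outcome-probability a n w 1≤a = begin
  (M ⊘ An) * (1ℚ ⊘ M)    ≡⟨ ⊘-* M 1ℚ 0<An 0<M ⟩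
  (M * 1ℚ) ⊘ (An * M)    ≡⟨ cong (_⊘ (An * M)) (*-comm M 1ℚ) ⟩
  (1ℚ * M) ⊘ (An * M)    ≡⟨ ⊘-scale 1ℚ M 0<An 0<M ⟩
  1ℚ ⊘ An                ∎
  where
  open ≡-Reasoning
  M = multinomial a n w
  An = ℕ→ℚ (a ℕ.^ n)
  0<An : 0ℚ < An
  0<An = ℕ→ℚ-pos (ℕ.m^n>0 a {{ℕ.>-nonZero 1≤a}} n)
  0<M : 0ℚ < M
  0<M = 0<-⊘ (ℕ→ℚ-pos (ℕ.>-nonZero⁻¹ (n ℕ.!) {{ℕ._!≢0 n}}))
             (ℕ→ℚ-pos (productℕ-pos _ (allFin a) (λ j → ℕ.>-nonZero⁻¹ (packetSize w j ℕ.!) {{ℕ._!≢0 (packetSize w j)}})))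

Q-count : ∀ a n i → 1 ≤ℕ a →
          Q a n i ≡ ℕ→ℚ (sumOver (words a n) (λ w → δ (shuffledDeck w at i) n)) ⊘ ℕ→ℚ (a ℕ.^ n)
Q-count a n i 1≤a = begin
  Q a n i
    ≡⟨ cong sumℚ (List.map-cong (λ w → cong₂ _*_ (outcome-probability a n w 1≤a) (indicator-δ (hit w) n)) (words a n)) ⟩
  sumℚ (map (λ w → (1ℚ ⊘ An) * ℕ→ℚ (δ (hit w) n)) (words a n))
    ≡⟨ sumℚ-linear (1ℚ ⊘ An) (λ w → δ (hit w) n) (words a n) ⟩
  (1ℚ ⊘ An) * ℕ→ℚ (sumOver (words a n) (λ w → δ (hit w) n))
    ≡⟨ 1⊘-* (ℕ→ℚ (sumOver (words a n) (λ w → δ (hit w) n))) (ℕ→ℚ-pos (ℕ.m^n>0 a {{ℕ.>-nonZero 1≤a}} n)) ⟩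
  ℕ→ℚ (sumOver (words a n) (λ w → δ (hit w) n)) ⊘ An ∎
  where open ≡-Reasoning
        An = ℕ→ℚ (a ℕ.^ n)
        hit = λ (w : List (Fin a)) → shuffledDeck w at i

Q-powerSum : ∀ b p q → Q (suc b) (suc (p + q)) (suc p) ≡ ℕ→ℚ (powerSum p q (suc b)) ⊘ ℕ→ℚ (suc b ℕ.^ suc (p + q))
Q-powerSum b p q = trans (Q-count (suc b) (suc (p + q)) (suc p) (s≤s z≤n))
  (cong (λ N → ℕ→ℚ N ⊘ ℕ→ℚ (suc b ℕ.^ suc (p + q))) (bottom-card-count (suc b) p q))

module Shuffle (b : ℕ) where
  a : ℕ
  a = suc b
  A B : ℚ
  A = ℕ→ℚ a
  B = ℕ→ℚ b

  0<A : 0ℚ < A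
  0<A = ℕ→ℚ-pos {a} (s≤s z≤n)

  0<A^ : ∀ k → 0ℚ < A ^ℚ k
  0<A^ k = 0<-^ k 0<A

  α-ratio : α a ≡ B ⊘ A
  α-ratio = begin
    1ℚ - 1ℚ ⊘ A    ≡⟨ 1-⊘ 1ℚ 0<A ⟩
    (A - 1ℚ) ⊘ A   ≡⟨ cong (_⊘ A) (sym (ℕ→ℚ-∸ {a} {1} (s≤s z≤n))) ⟩
    B ⊘ A          ∎
    where open ≡-Reasoning

  α-range : 0ℚ ≤ α a × α a ≤ 1ℚ
  α-range = subst (0ℚ ≤_) (sym α-ratio) nonneg , subst (_≤ 1ℚ) (sym α-ratio) at-most-one
    where
    nonneg : 0ℚ ≤ B ⊘ A
    nonneg = subst (0ℚ ≤_) (1⊘-* B 0<A) (0≤-* (<⇒≤ (0<-⊘ (ℕ→ℚ-pos {1} (s≤s z≤n)) 0<A)) (ℕ→ℚ-mono-≤ {0} {b} z≤n))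
    at-most-one : B ⊘ A ≤ 1ℚ
    at-most-one = subst (B ⊘ A ≤_) (⊘-unique 1ℚ 1ℚ (ℕ→ℚ-pos {1} (s≤s z≤n)) refl)
                        (ℕ-fraction-≤ b a 1 1 (s≤s z≤n) (s≤s z≤n)
                          (subst₂ ℕ._≤_ (sym (ℕ.*-identityʳ b)) (sym (ℕ.*-identityˡ a)) (ℕ.n≤1+n b)))

  one-minus-α^ : ∀ k → 1ℚ - α a ^ℚ k ≡ ℕ→ℚ (Δ k b) ⊘ A ^ℚ k
  one-minus-α^ k = begin
    1ℚ - α a ^ℚ k               ≡⟨ cong (λ x → 1ℚ - x ^ℚ k) α-ratio ⟩
    1ℚ - (B ⊘ A) ^ℚ k           ≡⟨ cong (1ℚ -_) (⊘-^ B k 0<A) ⟩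
    1ℚ - B ^ℚ k ⊘ A ^ℚ k        ≡⟨ 1-⊘ (B ^ℚ k) (0<A^ k) ⟩
    (A ^ℚ k - B ^ℚ k) ⊘ A ^ℚ k  ≡⟨ cong (_⊘ A ^ℚ k) (sym difference) ⟩
    ℕ→ℚ (Δ k b) ⊘ A ^ℚ k        ∎
    where
    open ≡-Reasoning
    difference : ℕ→ℚ (Δ k b) ≡ A ^ℚ k - B ^ℚ k
    difference = trans (ℕ→ℚ-∸ (ℕ.^-monoˡ-≤ k (ℕ.n≤1+n b))) (cong₂ _-_ (ℕ→ℚ-^ a k) (ℕ→ℚ-^ b k))

  0<Δ : ∀ k → 1 ≤ℕ k → 0ℚ < ℕ→ℚ (Δ k b)
  0<Δ k 1≤k = ℕ→ℚ-pos (Δ-pos k b 1≤k)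

  0<1-α^ : ∀ k → 1 ≤ℕ k → 0ℚ < 1ℚ - α a ^ℚ k
  0<1-α^ k 1≤k = subst (0ℚ <_) (sym (one-minus-α^ k)) (0<-⊘ (0<Δ k 1≤k) (0<A^ k))

  α-fraction : ∀ j k → 1 ≤ℕ k →
    (1ℚ ⊘ A) * (α a ^ℚ j ⊘ (1ℚ - α a ^ℚ k)) ≡ ℕ→ℚ (a ℕ.^ k ℕ.* b ℕ.^ j) ⊘ ℕ→ℚ (a ℕ.^ suc j ℕ.* Δ k b)
  α-fraction j k 1≤k = begin
    (1ℚ ⊘ A) * (α a ^ℚ j ⊘ (1ℚ - α a ^ℚ k))
      ≡⟨ cong₂ (λ x y → (1ℚ ⊘ A) * (x ⊘ y)) (trans (cong (_^ℚ j) α-ratio) (⊘-^ B j 0<A)) (one-minus-α^ k) ⟩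
    (1ℚ ⊘ A) * ((B ^ℚ j ⊘ A ^ℚ j) ⊘ (E ⊘ A ^ℚ k))
      ≡⟨ cong ((1ℚ ⊘ A) *_) (⊘-⊘ (B ^ℚ j) (0<A^ j) (0<Δ k 1≤k) (0<A^ k)) ⟩
    (1ℚ ⊘ A) * ((B ^ℚ j * A ^ℚ k) ⊘ (A ^ℚ j * E))
      ≡⟨ ⊘-* 1ℚ (B ^ℚ j * A ^ℚ k) 0<A (0<-* (0<A^ j) (0<Δ k 1≤k)) ⟩
    (1ℚ * (B ^ℚ j * A ^ℚ k)) ⊘ (A * (A ^ℚ j * E))
      ≡⟨ cong₂ _⊘_ numerator denominator ⟩
    ℕ→ℚ (a ℕ.^ k ℕ.* b ℕ.^ j) ⊘ ℕ→ℚ (a ℕ.^ suc j ℕ.* Δ k b) ∎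
    where
    open ≡-Reasoning
    E = ℕ→ℚ (Δ k b)
    numerator : 1ℚ * (B ^ℚ j * A ^ℚ k) ≡ ℕ→ℚ (a ℕ.^ k ℕ.* b ℕ.^ j)
    numerator = begin
      1ℚ * (B ^ℚ j * A ^ℚ k)               ≡⟨ trans (*-identityˡ _) (*-comm (B ^ℚ j) _) ⟩
      A ^ℚ k * B ^ℚ j                      ≡⟨ sym (cong₂ _*_ (ℕ→ℚ-^ a k) (ℕ→ℚ-^ b j)) ⟩
      ℕ→ℚ (a ℕ.^ k) * ℕ→ℚ (b ℕ.^ j)        ≡⟨ sym (ℕ→ℚ-* (a ℕ.^ k) (b ℕ.^ j)) ⟩
      ℕ→ℚ (a ℕ.^ k ℕ.* b ℕ.^ j)            ∎
    denominator : A * (A ^ℚ j * E) ≡ ℕ→ℚ (a ℕ.^ suc j ℕ.* Δ k b)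
    denominator = begin
      A * (A ^ℚ j * E)                     ≡⟨ sym (*-assoc A (A ^ℚ j) E) ⟩
      A ^ℚ suc j * E                       ≡⟨ cong (_* E) (sym (ℕ→ℚ-^ a (suc j))) ⟩
      ℕ→ℚ (a ℕ.^ suc j) * E                ≡⟨ sym (ℕ→ℚ-* (a ℕ.^ suc j) (Δ k b)) ⟩
      ℕ→ℚ (a ℕ.^ suc j ℕ.* Δ k b)          ∎

  upper-cross : ∀ p q → 1 ≤ℕ p + q →
    powerSum p q a ℕ.* (a ℕ.^ suc q ℕ.* Δ (p + q) b) ≤ℕ (a ℕ.^ (p + q) ℕ.* b ℕ.^ q) ℕ.* a ℕ.^ suc (p + q)
  upper-cross p q 1≤m = begin
    S ℕ.* (a ℕ.^ suc q ℕ.* Δ m b)                  ≡⟨ left-comm S (a ℕ.^ suc q) (Δ m b) ⟩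
    a ℕ.^ suc q ℕ.* (S ℕ.* Δ m b)                  ≤⟨ ℕ.*-monoʳ-≤ (a ℕ.^ suc q) (powerSum-upper p q b 1≤m) ⟩
    a ℕ.^ suc q ℕ.* (a ℕ.^ m ℕ.* (a ℕ.^ p ℕ.* b ℕ.^ q)) ≡⟨ regroup (a ℕ.^ suc q) (a ℕ.^ m) (a ℕ.^ p) (b ℕ.^ q) ⟩
    (a ℕ.^ m ℕ.* b ℕ.^ q) ℕ.* (a ℕ.^ p ℕ.* a ℕ.^ suc q) ≡⟨ cong ((a ℕ.^ m ℕ.* b ℕ.^ q) ℕ.*_) (sym (ℕ.^-distribˡ-+-* a p (suc q))) ⟩
    (a ℕ.^ m ℕ.* b ℕ.^ q) ℕ.* a ℕ.^ (p + suc q)   ≡⟨ cong (λ e → (a ℕ.^ m ℕ.* b ℕ.^ q) ℕ.* a ℕ.^ e) (ℕ.+-suc p q) ⟩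
    (a ℕ.^ m ℕ.* b ℕ.^ q) ℕ.* a ℕ.^ suc m          ∎
    where
    open ℕ.≤-Reasoning
    m = p + q
    S = powerSum p q a
    left-comm : ∀ x y z → x ℕ.* (y ℕ.* z) ≡ y ℕ.* (x ℕ.* z)
    left-comm = solve-∀
    regroup : ∀ Aq Am Ap Bq → Aq ℕ.* (Am ℕ.* (Ap ℕ.* Bq)) ≡ (Am ℕ.* Bq) ℕ.* (Ap ℕ.* Aq)
    regroup = solve-∀

  lower-cross : ∀ p q →
    (a ℕ.^ suc (p + q) ℕ.* b ℕ.^ suc q) ℕ.* a ℕ.^ suc (p + q)
      ≤ℕ powerSum p q a ℕ.* (a ℕ.^ suc (suc q) ℕ.* Δ (suc (p + q)) b)
  lower-cross p q = begin
    (a ℕ.^ n ℕ.* b ℕ.^ suc q) ℕ.* a ℕ.^ n                  ≡⟨ regroup ⟩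
    a ℕ.^ suc (suc q) ℕ.* (a ℕ.^ (p + m) ℕ.* b ℕ.^ suc q)  ≤⟨ ℕ.*-monoʳ-≤ (a ℕ.^ suc (suc q)) (powerSum-lower p q b) ⟩
    a ℕ.^ suc (suc q) ℕ.* (S ℕ.* Δ n b)                    ≡⟨ left-comm (a ℕ.^ suc (suc q)) S (Δ n b) ⟩
    S ℕ.* (a ℕ.^ suc (suc q) ℕ.* Δ n b)                    ∎
    where
    open ℕ.≤-Reasoning
    m = p + q
    n = suc m
    S = powerSum p q a
    left-comm : ∀ x y z → x ℕ.* (y ℕ.* z) ≡ y ℕ.* (x ℕ.* z)
    left-comm = solve-∀
    exponents : ∀ p q → suc (p + q) + suc (p + q) ≡ suc (suc q) + (p + (p + q))
    exponents = solve-∀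
    regroup : (a ℕ.^ n ℕ.* b ℕ.^ suc q) ℕ.* a ℕ.^ n ≡ a ℕ.^ suc (suc q) ℕ.* (a ℕ.^ (p + m) ℕ.* b ℕ.^ suc q)
    regroup = begin-equality
      (a ℕ.^ n ℕ.* b ℕ.^ suc q) ℕ.* a ℕ.^ n               ≡⟨ swap (a ℕ.^ n) (b ℕ.^ suc q) ⟩
      (a ℕ.^ n ℕ.* a ℕ.^ n) ℕ.* b ℕ.^ suc q               ≡⟨ cong (ℕ._* b ℕ.^ suc q) (sym (ℕ.^-distribˡ-+-* a n n)) ⟩
      a ℕ.^ (n + n) ℕ.* b ℕ.^ suc q                       ≡⟨ cong (λ e → a ℕ.^ e ℕ.* b ℕ.^ suc q) (exponents p q) ⟩
      a ℕ.^ (suc (suc q) + (p + m)) ℕ.* b ℕ.^ suc q       ≡⟨ cong (ℕ._* b ℕ.^ suc q) (ℕ.^-distribˡ-+-* a (suc (suc q)) (p + m)) ⟩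
      (a ℕ.^ suc (suc q) ℕ.* a ℕ.^ (p + m)) ℕ.* b ℕ.^ suc q ≡⟨ ℕ.*-assoc (a ℕ.^ suc (suc q)) _ _ ⟩
      a ℕ.^ suc (suc q) ℕ.* (a ℕ.^ (p + m) ℕ.* b ℕ.^ suc q) ∎
      where swap : ∀ x y → x ℕ.* y ℕ.* x ≡ x ℕ.* x ℕ.* y
            swap = solve-∀

  1≤a^ : ∀ k → 1 ≤ℕ a ℕ.^ k
  1≤a^ k = ℕ.m^n>0 a k

  Q-upper : ∀ p q → 1 ≤ℕ p + q →
    Q a (suc (p + q)) (suc p) ≤ (1ℚ ⊘ A) * (α a ^ℚ q ⊘ (1ℚ - α a ^ℚ (p + q)))
  Q-upper p q 1≤m = subst₂ _≤_ (sym (Q-powerSum b p q)) (sym (α-fraction q (p + q) 1≤m))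
    (ℕ-fraction-≤ (powerSum p q a) (a ℕ.^ suc (p + q)) (a ℕ.^ (p + q) ℕ.* b ℕ.^ q) (a ℕ.^ suc q ℕ.* Δ (p + q) b)
                  (1≤a^ (suc (p + q))) (ℕ.*-mono-≤ (1≤a^ (suc q)) (Δ-pos (p + q) b 1≤m))
                  (upper-cross p q 1≤m))

  Q-lower : ∀ p q →
    (1ℚ ⊘ A) * (α a ^ℚ suc q ⊘ (1ℚ - α a ^ℚ suc (p + q))) ≤ Q a (suc (p + q)) (suc p)
  Q-lower p q = subst₂ _≤_ (sym (α-fraction (suc q) (suc (p + q)) (s≤s z≤n))) (sym (Q-powerSum b p q))
    (ℕ-fraction-≤ (a ℕ.^ suc (p + q) ℕ.* b ℕ.^ suc q) (a ℕ.^ suc (suc q) ℕ.* Δ (suc (p + q)) b)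
                  (powerSum p q a) (a ℕ.^ suc (p + q)) (ℕ.*-mono-≤ (1≤a^ (suc (suc q))) (Δ-pos (suc (p + q)) b (s≤s z≤n))) (1≤a^ (suc (p + q)))
                  (lower-cross p q))

  position-bounds : ∀ m → 1 ≤ℕ m → ∀ i → 1 ≤ℕ i → i ≤ℕ suc m →
      ((1ℚ ⊘ A) * (α a ^ℚ (suc m ∸ i + 1) ⊘ (1ℚ - α a ^ℚ suc m)) ≤ Q a (suc m) i)
    × (Q a (suc m) i ≤ (1ℚ ⊘ A) * (α a ^ℚ (suc m ∸ i) ⊘ (1ℚ - α a ^ℚ (suc m ∸ 1))))
  position-bounds m 1≤m (suc p) _ (s≤s p≤m) = split (m ∸ p) (ℕ.m+[n∸m]≡n p≤m)
    where
    split : ∀ q → p + q ≡ m →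
        ((1ℚ ⊘ A) * (α a ^ℚ (m ∸ p + 1) ⊘ (1ℚ - α a ^ℚ suc m)) ≤ Q a (suc m) (suc p))
      × (Q a (suc m) (suc p) ≤ (1ℚ ⊘ A) * (α a ^ℚ (m ∸ p) ⊘ (1ℚ - α a ^ℚ m)))
    split q refl rewrite ℕ.m+n∸m≡n p q | ℕ.+-comm q 1 = Q-lower p q , Q-upper p q 1≤m

  -- As 0 ≤ α ≤ 1 and (m+1) − i + 1 ≤ m+1, every lower-bound power is at least α^{m+1}.
  α^-≤ : ∀ m i → 1 ≤ℕ i → i ≤ℕ suc m → α a ^ℚ suc m ≤ α a ^ℚ (suc m ∸ i + 1)
  α^-≤ m (suc p) _ (s≤s p≤m) =
    subst (λ e → α a ^ℚ e ≤ α a ^ℚ (m ∸ p + 1)) exponent (^ℚ-antitone p (m ∸ p + 1) (proj₁ α-range) (proj₂ α-range))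
    where exponent : p + (m ∸ p + 1) ≡ suc m
          exponent = trans (cong (p +_) (ℕ.+-comm (m ∸ p) 1)) (trans (ℕ.+-suc p (m ∸ p)) (cong suc (ℕ.m+[n∸m]≡n p≤m)))

  0≤1⊘A : 0ℚ ≤ 1ℚ ⊘ A
  0≤1⊘A = <⇒≤ (0<-⊘ (ℕ→ℚ-pos {1} (s≤s z≤n)) 0<A)

maxUpTo-≥-first : ∀ k (f : ℕ → ℚ) → f 1 ≤ maxUpTo k f
maxUpTo-≥-first zero          f = ≤-refl
maxUpTo-≥-first (suc zero)    f = ≤-refl
maxUpTo-≥-first (suc (suc k)) f = ≤-trans (maxUpTo-≥-first (suc k) f) (p≤p⊔q _ _)

maxUpTo-least : ∀ k (f : ℕ → ℚ) c → 1 ≤ℕ k → (∀ i → 1 ≤ℕ i → i ≤ℕ k → f i ≤ c) → maxUpTo k f ≤ c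
maxUpTo-least (suc zero)    f c _ f≤c = f≤c 1 (s≤s z≤n) (s≤s z≤n)
maxUpTo-least (suc (suc k)) f c _ f≤c =
  ⊔-lub (maxUpTo-least (suc k) f c (s≤s z≤n) (λ i 1≤i i≤k → f≤c i 1≤i (ℕ.m≤n⇒m≤1+n i≤k)))
        (f≤c (suc (suc k)) (s≤s z≤n) ℕ.≤-refl)

1-antitone : ∀ {x y} → y ≤ x → 1ℚ - x ≤ 1ℚ - y
1-antitone y≤x = +-monoʳ-≤ 1ℚ (neg-antimono-≤ y≤x)

-- The separation distance: its lower bound comes from the upper bound on Q_a(1),
-- its upper bound from the smallest of the lower bounds on Q_a(i).
module Separation (b m : ℕ) (1≤m : 1 ≤ℕ m) where
  open Shuffle b

  N : ℚ
  N = ℕ→ℚ (suc m)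

  N* : ∀ {x y} → x ≤ y → N * x ≤ N * y
  N* = *-monoˡ-≤-nonNeg N {{nonNegative (ℕ→ℚ-mono-≤ {0} {suc m} z≤n)}}

  SEP-lower : 1ℚ - N * (1ℚ ⊘ A) * (α a ^ℚ m ⊘ (1ℚ - α a ^ℚ m)) ≤ SEP a (suc m)
  SEP-lower = ≤-trans
    (1-antitone (subst (N * Q a (suc m) 1 ≤_) (sym (*-assoc N _ _))
                       (N* (proj₂ (position-bounds m 1≤m 1 (s≤s z≤n) (s≤s z≤n))))))
    (maxUpTo-≥-first (suc m) (λ i → 1ℚ - N * Q a (suc m) i))

  SEP-upper : SEP a (suc m) ≤ 1ℚ - N * (1ℚ ⊘ A) * (α a ^ℚ suc m ⊘ (1ℚ - α a ^ℚ suc m))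
  SEP-upper = maxUpTo-least (suc m) (λ i → 1ℚ - N * Q a (suc m) i) _ (s≤s z≤n) (λ i 1≤i i≤n →
    1-antitone (begin
      N * (1ℚ ⊘ A) * (α a ^ℚ suc m ⊘ D)       ≡⟨ *-assoc N _ _ ⟩
      N * ((1ℚ ⊘ A) * (α a ^ℚ suc m ⊘ D))     ≤⟨ N* (*-monoˡ-≤-nonNeg (1ℚ ⊘ A) {{nonNegative 0≤1⊘A}}
                                                      (⊘-monoˡ-≤ D (0<1-α^ (suc m) (s≤s z≤n)) (α^-≤ m i 1≤i i≤n))) ⟩
      N * ((1ℚ ⊘ A) * (α a ^ℚ (suc m ∸ i + 1) ⊘ D)) ≤⟨ N* (proj₁ (position-bounds m 1≤m i 1≤i i≤n)) ⟩
      N * Q a (suc m) i                        ∎))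
    where open ≤-Reasoning
          D = 1ℚ - α a ^ℚ suc m

proposition3p4 : (n a : ℕ) → 2 ≤ℕ n → 1 ≤ℕ a →
    ((i : ℕ) → 1 ≤ℕ i → i ≤ℕ n →
      ((1ℚ ⊘ ℕ→ℚ a) * (α a ^ℚ (n ∸ i + 1) ⊘ (1ℚ - α a ^ℚ n)) ≤ Q a n i)
      × (Q a n i ≤ (1ℚ ⊘ ℕ→ℚ a) * (α a ^ℚ (n ∸ i) ⊘ (1ℚ - α a ^ℚ (n ∸ 1)))))
    × ((1ℚ - ℕ→ℚ n * (1ℚ ⊘ ℕ→ℚ a) * (α a ^ℚ (n ∸ 1) ⊘ (1ℚ - α a ^ℚ (n ∸ 1))) ≤ SEP a n)
      × (SEP a n ≤ 1ℚ - ℕ→ℚ n * (1ℚ ⊘ ℕ→ℚ a) * (α a ^ℚ n ⊘ (1ℚ - α a ^ℚ n))))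
proposition3p4 (suc m) (suc b) (s≤s 1≤m) _ = position-bounds m 1≤m , SEP-lower , SEP-upper
  where open Shuffle b
        open Separation b m 1≤m
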